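{- Let $\mathbf{n}=(n_1,\ldots,n_d)$ be a tuple of positive integers and let $$\mathcal{F}_{\mathbf{n}}(\mathbf{x},\mathbf{z})=\sum_{F\in\mathcal{F}(\mathbf{n})}\ \prod_{s\in[d]}z_s^{\mathrm{root}_s(F)}\prod_{s,t\in[d],\,i\in[n_t]}x_{s,t,i}^{\mathrm{ch}_s(t,i)}.$$ Then $$\mathcal{F}_{\mathbf{n}}(\mathbf{x},\mathbf{z})=\prod_{s\in[d]}\Bigg(z_s+\sum_{t\in[d],\,i\in[n_t]}x_{s,t,i}\Bigg)^{n_s-1}\times \Gamma,\qquad \Gamma=\sum_{B\in F_d}\Bigg(\prod_{s\text{ root vertex of }B}z_s\Bigg)\prod_{(s,t)\in B}\Bigg(\sum_{i\in[n_t]}x_{s,t,i}\Bigg).$$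
   Context: $\mathcal{F}(\mathbf{n})$ is the set of rooted forests with vertex set $\{(t,i): t\in[d],\ i\in[n_t]\}$ (a rooted forest is an acyclic graph in which each connected component has a distinguished root vertex; each component is oriented toward its root). The vertex $(t,i)$ has type $t$. For $F\in\mathcal{F}(\mathbf{n})$, $\mathrm{ch}_s(t,i)$ is the number of children of type $s$ of the vertex $(t,i)$, and $\mathrm{root}_s(F)$ is the number of root vertices of type $s$. $F_d$ is the set of rooted forests with vertex set $[d]$, each component oriented toward its root; $(s,t)\in B$ means the oriented edge from $s$ to $t$ belongs to $B$. -}

module Defs where

open import Level using (Level)
open import Data.Nat using (ℕ; zero; suc; _∸_)
open import Data.Fin using (Fin; zero; suc)
open import Data.Fin.Properties using () renaming (_≟_ to _≟F_)
open import Data.Product using (Σ; _,_; _×_; proj₁; proj₂)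
open import Data.Product.Properties using () renaming (≡-dec to Σ-≡-dec)
open import Data.Maybe using (Maybe; just; nothing; is-nothing)
open import Data.Maybe.Properties using () renaming (≡-dec to Maybe-≡-dec)
open import Data.List using (List; []; _∷_; [_]; map; concatMap; filter; foldr; length; allFin)
open import Data.List.Relation.Unary.All using (All; all?)
open import Data.Bool using (T)
open import Relation.Nullary using (Dec)
open import Relation.Nullary.Decidable using (T?)
open import Relation.Binary.PropositionalEquality using (_≡_)
open import Relation.Binary.Definitions using (DecidableEquality)
open import Algebra.Bundles using (CommutativeSemiring)

consF : ∀ {a} {k : ℕ} {B : Fin (suc k) → Set a} →
        B zero → ((i : Fin k) → B (suc i)) → (i : Fin (suc k)) → B i
consF b f zero    = b
consF b f (suc i) = f i

dfuns : ∀ {a} (k : ℕ) (B : Fin k → Set a) → ((t : Fin k) → List (B t)) →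
        List ((t : Fin k) → B t)
dfuns zero    B bs = [ (λ ()) ]
dfuns (suc k) B bs =
  concatMap (λ b → map (λ f → consF {B = B} b f)
                       (dfuns k (λ i → B (suc i)) (λ i → bs (suc i))))
            (bs zero)

funs : ∀ {a} {B : Set a} (k : ℕ) → List B → List (Fin k → B)
funs {B = B} k bs = dfuns k (λ _ → B) (λ _ → bs)

-- A rooted forest (components oriented towards their roots) on a finite
-- vertex set V is the same as a map  p : V → Maybe V  (p v = nothing iff v
-- is a root, p v = just w iff the oriented edge v → w is in the forest)
-- without cycles. Acyclicity: following parents |V| times from any vertex
-- leaves the vertex set (i.e. reaches "above" a root).

iterParent : ∀ {V : Set} → (V → Maybe V) → ℕ → V → Maybe V
iterParent p zero    v = just v
iterParent p (suc k) v with iterParent p k v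
... | nothing = nothing
... | just w  = p w

-- vs is the (complete, duplicate-free) list of vertices
IsForest : ∀ {V : Set} → List V → (V → Maybe V) → Set
IsForest vs p = All (λ v → T (is-nothing (iterParent p (length vs) v))) vs

isForest? : ∀ {V : Set} (vs : List V) (p : V → Maybe V) → Dec (IsForest vs p)
isForest? vs p = all? (λ v → T? (is-nothing (iterParent p (length vs) v))) vs

Vertex : (d : ℕ) → (Fin d → ℕ) → Set
Vertex d n = Σ (Fin d) (λ t → Fin (n t))

_≟V_ : ∀ {d n} → DecidableEquality (Vertex d n)
_≟V_ = Σ-≡-dec _≟F_ _≟F_

vertices : (d : ℕ) (n : Fin d → ℕ) → List (Vertex d n)
vertices d n = concatMap (λ t → map (λ i → (t , i)) (allFin (n t))) (allFin d)

ParentMap : (d : ℕ) → (Fin d → ℕ) → Set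
ParentMap d n = Vertex d n → Maybe (Vertex d n)

allParentMaps : (d : ℕ) (n : Fin d → ℕ) → List (ParentMap d n)
allParentMaps d n =
  map (λ g v → g (proj₁ v) (proj₂ v))
      (dfuns d (λ t → Fin (n t) → Maybe (Vertex d n))
               (λ t → funs (n t) (nothing ∷ map just (vertices d n))))

forests : (d : ℕ) (n : Fin d → ℕ) → List (ParentMap d n)
forests d n = filter (isForest? (vertices d n)) (allParentMaps d n)

root : ∀ {d n} → ParentMap d n → Fin d → ℕ
root {d} {n} F s =
  length (filter (λ j → T? (is-nothing (F (s , j)))) (allFin (n s)))

ch : ∀ {d n} → ParentMap d n → Fin d → Vertex d n → ℕ
ch {d} {n} F s v =
  length (filter (λ j → Maybe-≡-dec _≟V_ (F (s , j)) (just v)) (allFin (n s)))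

ParentMapD : ℕ → Set
ParentMapD d = Fin d → Maybe (Fin d)

forestsD : (d : ℕ) → List (ParentMapD d)
forestsD d = filter (isForest? (allFin d))
                    (funs d (nothing ∷ map just (allFin d)))

-- (s,t) ∈ B  iff the oriented edge s → t is in B
edges : ∀ {d} → ParentMapD d → List (Fin d × Fin d)
edges {d} B =
  filter (λ st → Maybe-≡-dec _≟F_ (B (proj₁ st)) (just (proj₂ st)))
         (concatMap (λ s → map (λ t → (s , t)) (allFin d)) (allFin d))

rootsD : ∀ {d} → ParentMapD d → List (Fin d)
rootsD {d} B = filter (λ s → T? (is-nothing (B s))) (allFin d)

module _ {c ℓ} (R : CommutativeSemiring c ℓ) where
  open CommutativeSemiring R

  sumL : List Carrier → Carrier
  sumL = foldr _+_ 0#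

  prodL : List Carrier → Carrier
  prodL = foldr _*_ 1#

  pow : Carrier → ℕ → Carrier
  pow x zero    = 1#
  pow x (suc k) = x * pow x k

  module _ (d : ℕ) (n : Fin d → ℕ)
           (x : Fin d → (t : Fin d) → Fin (n t) → Carrier)
           (z : Fin d → Carrier) where

    forestWeight : ParentMap d n → Carrier
    forestWeight F =
      prodL (map (λ s → pow (z s) (root F s)) (allFin d)) *
      prodL (map (λ s → prodL (map (λ t → prodL (map
              (λ i → pow (x s t i) (ch F s (t , i))) (allFin (n t))))
            (allFin d))) (allFin d))

    forestGF : Carrier
    forestGF = sumL (map forestWeight (forests d n))

    xsum : Fin d → Fin d → Carrier
    xsum s t = sumL (map (x s t) (allFin (n t)))

    Gamma : Carrier
    Gamma = sumL (map (λ B → prodL (map z (rootsD B)) *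
                             prodL (map (λ st → xsum (proj₁ st) (proj₂ st)) (edges B)))
                      (forestsD d))

    rhs : Carrier
    rhs = prodL (map (λ s → pow (z s + sumL (map (xsum s) (allFin d))) (n s ∸ 1))
                     (allFin d)) * Gamma

-- A forest is an acyclic parent map p : V → Maybe V, and its weight is a product of vertex
-- weights w u (p u).  Sorting the forests by the parent a of one vertex v and contracting the
-- edge v → a gives a contraction identity for such weighted forest sums.  Iterating it shows that
-- two vertices with equal weight rows can be merged: the sum factors into their common row sum
-- times the sum in which one of them is removed and the edges into it are redirected to the other.
-- All vertices of type s have the row z_s, x_{s,t,i}, so merging the n_s - 1 non-representatives
-- of each type into a representative contributes (z_s + Σ_{t,i} x_{s,t,i})^{n_s - 1}, and the
-- forests on the representatives are the forests on [d] with edge weights Σ_i x_{s,t,i}, giving Γ.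

module Submission where

open import Level using (Level)
open import Function using (_∘_; id; mk⇔)
open import Data.Nat using (ℕ; zero; suc; _∸_; _≤_; _<_; s≤s; z≤n)
import Data.Nat.Properties as ℕ
open import Data.Fin using (Fin; zero; suc; toℕ; fromℕ<)
open import Data.Fin.Properties using (injective⇒≤; toℕ-injective; toℕ<n; suc-injective)
  renaming (_≟_ to _≟F_)
open import Data.List using (List; []; _∷_; map; concatMap; filter; foldr; length; allFin; lookup; _++_)
open import Data.List.Properties using (map-tabulate; length-tabulate; filter-all; filter-reject)
open import Data.List.Membership.Propositional using (_∈_; _∉_)
open import Data.List.Membership.Propositional.Properties
  using (∈-allFin; ∈-map⁺; ∈-map⁻; ∈-concatMap⁺; ∈-concatMap⁻; ∈-filter⁺; ∈-filter⁻)
open import Data.List.Relation.Unary.Any as Any using (Any; here; there)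
open import Data.List.Relation.Unary.Any.Properties using (lookup-index)
open import Data.List.Relation.Unary.All as All using (All; []; _∷_)
open import Data.List.Relation.Unary.AllPairs using ([]; _∷_)
open import Data.List.Relation.Unary.Unique.Propositional using (Unique)
import Data.List.Relation.Unary.Unique.Propositional.Properties as Unique
open import Data.Maybe using (Maybe; just; nothing; is-nothing; maybe′)
open import Data.Maybe.Properties using (just-injective) renaming (≡-dec to Maybe-≡-dec)
open import Data.Product using (Σ; _,_; proj₁; proj₂; _×_)
open import Data.Sum using (_⊎_; inj₁; inj₂)
open import Data.Bool using (Bool; true; false; if_then_else_; T)
open import Data.Unit using (tt)
open import Data.Empty using (⊥; ⊥-elim)
open import Relation.Nullary using (Dec; yes; no; does; ¬_)
open import Relation.Nullary.Decidable using (T?; ¬?; does-⇔)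
open import Relation.Binary.Definitions using (DecidableEquality)
open import Relation.Binary.PropositionalEquality
  using (_≡_; _≢_; refl; sym; trans; cong; subst; _≗_)
open import Algebra.Bundles using (CommutativeMonoid; CommutativeSemiring)
open import Defs

private
  variable
    a b p : Level
    A : Set a
    B : Set b
    P : Set p

module ListFolds {c ℓ} (M : CommutativeMonoid c ℓ) where
  open CommutativeMonoid M
    renaming (Carrier to C; refl to ≈-refl; sym to ≈-sym; trans to ≈-trans)
  open import Algebra.Properties.CommutativeSemigroup commutativeSemigroup using (interchange)
  open import Relation.Binary.Reasoning.Setoid setoid

  fold : (A → C) → List A → C
  fold f xs = foldr _∙_ ε (map f xs)

  guard : Dec P → C → C
  guard p x = if does p then x else ε

  fold-cong : ∀ {f g : A → C} xs → (∀ x → f x ≈ g x) → fold f xs ≈ fold g xs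
  fold-cong []       f≈g = ≈-refl
  fold-cong (x ∷ xs) f≈g = ∙-cong (f≈g x) (fold-cong xs f≈g)

  fold-cong-∈ : ∀ {f g : A → C} xs → (∀ x → x ∈ xs → f x ≈ g x) → fold f xs ≈ fold g xs
  fold-cong-∈ []       f≈g = ≈-refl
  fold-cong-∈ (x ∷ xs) f≈g = ∙-cong (f≈g x (here refl)) (fold-cong-∈ xs (λ y y∈ → f≈g y (there y∈)))

  fold-++ : ∀ (f : A → C) xs ys → fold f (xs ++ ys) ≈ fold f xs ∙ fold f ys
  fold-++ f []       ys = ≈-sym (identityˡ _)
  fold-++ f (x ∷ xs) ys = ≈-trans (∙-congˡ (fold-++ f xs ys)) (≈-sym (assoc _ _ _))

  fold-map : ∀ (f : B → C) (g : A → B) xs → fold f (map g xs) ≡ fold (f ∘ g) xs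
  fold-map f g []       = refl
  fold-map f g (x ∷ xs) = cong (f (g x) ∙_) (fold-map f g xs)

  fold-concatMap : ∀ (f : B → C) (g : A → List B) xs →
                   fold f (concatMap g xs) ≈ fold (λ x → fold f (g x)) xs
  fold-concatMap f g []       = ≈-refl
  fold-concatMap f g (x ∷ xs) =
    ≈-trans (fold-++ f (g x) (concatMap g xs)) (∙-congˡ (fold-concatMap f g xs))

  fold-ε : ∀ (xs : List A) → fold (λ _ → ε) xs ≈ ε
  fold-ε []       = ≈-refl
  fold-ε (x ∷ xs) = ≈-trans (identityˡ _) (fold-ε xs)

  fold-ε-∈ : ∀ {f : A → C} xs → (∀ x → x ∈ xs → f x ≈ ε) → fold f xs ≈ ε
  fold-ε-∈ xs f≈ε = ≈-trans (fold-cong-∈ xs f≈ε) (fold-ε xs)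

  fold-∙ : ∀ (f g : A → C) xs → fold (λ x → f x ∙ g x) xs ≈ fold f xs ∙ fold g xs
  fold-∙ f g []       = ≈-sym (identityˡ _)
  fold-∙ f g (x ∷ xs) = ≈-trans (∙-congˡ (fold-∙ f g xs)) (interchange _ _ _ _)

  fold-swap : ∀ (f : A → B → C) xs ys →
              fold (λ x → fold (f x) ys) xs ≈ fold (λ y → fold (λ x → f x y) xs) ys
  fold-swap f []       ys = ≈-sym (fold-ε ys)
  fold-swap f (x ∷ xs) ys = ≈-trans (∙-congˡ (fold-swap f xs ys)) (≈-sym (fold-∙ (f x) _ ys))

  fold-allFin-suc : ∀ k (f : Fin (suc k) → C) → fold f (allFin (suc k)) ≡ f zero ∙ fold (f ∘ suc) (allFin k)
  fold-allFin-suc k f = cong (λ l → f zero ∙ foldr _∙_ ε l)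
    (trans (map-tabulate suc f) (sym (map-tabulate id (f ∘ suc))))

  fold-filter : ∀ {P : A → Set p} (P? : ∀ x → Dec (P x)) (f : A → C) xs →
                fold f (filter P? xs) ≈ fold (λ x → guard (P? x) (f x)) xs
  fold-filter P? f []       = ≈-refl
  fold-filter P? f (x ∷ xs) with P? x
  ... | yes _ = ∙-congˡ (fold-filter P? f xs)
  ... | no  _ = ≈-trans (fold-filter P? f xs) (≈-sym (identityˡ _))

  module _ (_≟_ : DecidableEquality A) where

    without : A → (A → C) → A → C
    without b f x = if does (x ≟ b) then ε else f x

    fold-single : ∀ {xs b} (f : A → C) → Unique xs → b ∈ xs → fold (λ x → guard (x ≟ b) (f x)) xs ≈ f b
    fold-single {x ∷ xs} f (x∉ ∷ u) (here refl) with x ≟ x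
    ... | no x≢x = ⊥-elim (x≢x refl)
    ... | yes _  = ≈-trans (∙-congˡ (fold-ε-∈ xs off)) (identityʳ _)
      where
        off : ∀ y → y ∈ xs → guard (y ≟ x) (f y) ≈ ε
        off y y∈ with y ≟ x
        ... | no  _    = ≈-refl
        ... | yes refl = ⊥-elim (All.lookup x∉ y∈ refl)
    fold-single {x ∷ xs} {b} f (x∉ ∷ u) (there b∈) with x ≟ b
    ... | no  _    = ≈-trans (identityˡ _) (fold-single f u b∈)
    ... | yes refl = ⊥-elim (All.lookup x∉ b∈ refl)

    fold-extract : ∀ {xs b} (f : A → C) → Unique xs → b ∈ xs → fold f xs ≈ f b ∙ fold (without b f) xs
    fold-extract {xs} {b} f u b∈ = begin
      fold f xs                                             ≈⟨ fold-cong xs split ⟩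
      fold (λ x → guard (x ≟ b) (f x) ∙ without b f x) xs   ≈⟨ fold-∙ _ _ xs ⟩
      fold (λ x → guard (x ≟ b) (f x)) xs ∙ fold (without b f) xs ≈⟨ ∙-congʳ (fold-single f u b∈) ⟩
      f b ∙ fold (without b f) xs                           ∎
      where
        split : ∀ x → f x ≈ guard (x ≟ b) (f x) ∙ without b f x
        split x with x ≟ b
        ... | yes _ = ≈-sym (identityʳ _)
        ... | no  _ = ≈-sym (identityˡ _)

    fold-pick : ∀ {xs b} (f : A → C) → Unique xs → b ∈ xs →
                (∀ x → x ∈ xs → x ≢ b → f x ≈ ε) → fold f xs ≈ f b
    fold-pick {xs} {b} f u b∈ off =
      ≈-trans (fold-extract f u b∈) (≈-trans (∙-congˡ (fold-ε-∈ xs rest)) (identityʳ _))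
      where
        rest : ∀ x → x ∈ xs → without b f x ≈ ε
        rest x x∈ with x ≟ b
        ... | yes _   = ≈-refl
        ... | no  x≢b = off x x∈ x≢b

    fold-guard-just : ∀ {xs} (f : A → C) → Unique xs → (∀ y → y ∈ xs) →
                      ∀ m → fold (λ y → guard (Maybe-≡-dec _≟_ m (just y)) (f y)) xs ≈ maybe′ f ε m
    fold-guard-just {xs} f u complete nothing   = fold-ε xs
    fold-guard-just {xs} f u complete (just y₀) = ≈-trans (fold-pick _ u (complete y₀) off) at-y₀
      where
        off : ∀ y → y ∈ xs → y ≢ y₀ → guard (Maybe-≡-dec _≟_ (just y₀) (just y)) (f y) ≈ ε
        off y _ y≢y₀ with y₀ ≟ y
        ... | yes y₀≡y = ⊥-elim (y≢y₀ (sym y₀≡y))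
        ... | no  _    = ≈-refl
        at-y₀ : guard (Maybe-≡-dec _≟_ (just y₀) (just y₀)) (f y₀) ≈ f y₀
        at-y₀ with y₀ ≟ y₀
        ... | yes _     = ≈-refl
        ... | no  y₀≢y₀ = ⊥-elim (y₀≢y₀ refl)

    fold-scale : ∀ {xs b} (h f : A → C) k → Unique xs → b ∈ xs → h b ≈ k ∙ f b →
                 (∀ x → x ∈ xs → x ≢ b → h x ≈ f x) → fold h xs ≈ k ∙ fold f xs
    fold-scale {xs} {b} h f k u b∈ hb h≈f = begin
      fold h xs                         ≈⟨ fold-extract h u b∈ ⟩
      h b ∙ fold (without b h) xs       ≈⟨ ∙-cong hb (fold-cong-∈ xs rest) ⟩
      (k ∙ f b) ∙ fold (without b f) xs ≈⟨ assoc _ _ _ ⟩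
      k ∙ (f b ∙ fold (without b f) xs) ≈⟨ ∙-congˡ (≈-sym (fold-extract f u b∈)) ⟩
      k ∙ fold f xs                     ∎
      where
        rest : ∀ x → x ∈ xs → without b h x ≈ without b f x
        rest x x∈ with x ≟ b
        ... | yes _   = ≈-refl
        ... | no  x≢b = h≈f x x∈ x≢b

    fold-support : ∀ {xs} bs (f : A → C) → Unique xs → Unique bs → (∀ b → b ∈ bs → b ∈ xs) →
                   (∀ x → x ∈ xs → x ∉ bs → f x ≈ ε) → fold f xs ≈ fold f bs
    fold-support {xs} []       f ux ub bs⊆xs off = fold-ε-∈ xs (λ x x∈ → off x x∈ λ ())
    fold-support {xs} (b ∷ bs) f ux (b∉ ∷ ub) bs⊆xs off = begin
      fold f xs                   ≈⟨ fold-extract f ux (bs⊆xs b (here refl)) ⟩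
      f b ∙ fold (without b f) xs ≈⟨ ∙-congˡ (fold-support bs (without b f) ux ub (λ b' → bs⊆xs b' ∘ there) off′) ⟩
      f b ∙ fold (without b f) bs ≈⟨ ∙-congˡ (fold-cong-∈ bs kept) ⟩
      f b ∙ fold f bs             ∎
      where
        off′ : ∀ x → x ∈ xs → x ∉ bs → without b f x ≈ ε
        off′ x x∈ x∉ with x ≟ b
        ... | yes _   = ≈-refl
        ... | no  x≢b = off x x∈ λ { (here x≡b) → x≢b x≡b ; (there x∈bs) → x∉ x∈bs }
        kept : ∀ x → x ∈ bs → without b f x ≈ f x
        kept x x∈ with x ≟ b
        ... | yes refl = ⊥-elim (All.lookup b∉ x∈ refl)
        ... | no  _    = ≈-refl

    fold-cong-except₂ : ∀ {xs b₁ b₂} (f g : A → C) → Unique xs → b₁ ∈ xs → b₂ ∈ xs → b₁ ≢ b₂ →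
                        (∀ x → x ≢ b₁ → x ≢ b₂ → f x ≈ g x) → f b₁ ∙ f b₂ ≈ g b₁ ∙ g b₂ →
                        fold f xs ≈ fold g xs
    fold-cong-except₂ {xs} {b₁} {b₂} f g u b₁∈ b₂∈ b₁≢b₂ f≈g f₁₂≈g₁₂ = begin
      fold f xs                                 ≈⟨ split f ⟩
      (f b₁ ∙ f b₂) ∙ fold (rest f) xs          ≈⟨ ∙-cong f₁₂≈g₁₂ (fold-cong xs rest-cong) ⟩
      (g b₁ ∙ g b₂) ∙ fold (rest g) xs          ≈⟨ ≈-sym (split g) ⟩
      fold g xs                                 ∎
      where
        rest : (A → C) → A → C
        rest h = without b₂ (without b₁ h)
        split : ∀ h → fold h xs ≈ (h b₁ ∙ h b₂) ∙ fold (rest h) xs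
        split h = begin
          fold h xs                                           ≈⟨ fold-extract h u b₁∈ ⟩
          h b₁ ∙ fold (without b₁ h) xs                       ≈⟨ ∙-congˡ (fold-extract _ u b₂∈) ⟩
          h b₁ ∙ (without b₁ h b₂ ∙ fold (rest h) xs)         ≈⟨ ∙-congˡ (∙-congʳ (kept (b₂ ≟ b₁))) ⟩
          h b₁ ∙ (h b₂ ∙ fold (rest h) xs)                    ≈⟨ ≈-sym (assoc _ _ _) ⟩
          (h b₁ ∙ h b₂) ∙ fold (rest h) xs                    ∎
          where
            kept : (b₂≟b₁ : Dec (b₂ ≡ b₁)) → (if does b₂≟b₁ then ε else h b₂) ≈ h b₂
            kept (yes b₂≡b₁) = ⊥-elim (b₁≢b₂ (sym b₂≡b₁))
            kept (no  _)     = ≈-refl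
        rest-cong : ∀ x → rest f x ≈ rest g x
        rest-cong x with x ≟ b₂ | x ≟ b₁
        ... | yes _   | _       = ≈-refl
        ... | no  _   | yes _   = ≈-refl
        ... | no  x≢₂ | no  x≢₁ = f≈g x x≢₁ x≢₂

module SemiringSums {c ℓ} (R : CommutativeSemiring c ℓ) where
  open CommutativeSemiring R
    renaming (Carrier to C; refl to ≈-refl; sym to ≈-sym; trans to ≈-trans; zero to *-zero)
  open import Relation.Binary.Reasoning.Setoid setoid

  module Sum  = ListFolds +-commutativeMonoid
  module Prod = ListFolds *-commutativeMonoid
  open Sum  public using () renaming (fold to ∑; guard to guard+)
  open Prod public using () renaming (fold to ∏; guard to guard*)

  𝟙 : Dec P → C
  𝟙 p = if does p then 1# else 0#

  𝟙-yes : (p? : Dec P) → P → 𝟙 p? ≡ 1#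
  𝟙-yes (yes _) _ = refl
  𝟙-yes (no ¬p) p = ⊥-elim (¬p p)

  𝟙-no : (p? : Dec P) → ¬ P → 𝟙 p? ≡ 0#
  𝟙-no (yes p) ¬p = ⊥-elim (¬p p)
  𝟙-no (no _)  _  = refl

  guard+≈𝟙* : ∀ (p? : Dec P) x → guard+ p? x ≈ 𝟙 p? * x
  guard+≈𝟙* (yes _) x = ≈-sym (*-identityˡ x)
  guard+≈𝟙* (no _)  x = ≈-sym (zeroˡ x)

  ∑-distribˡ : ∀ k (f : A → C) xs → k * ∑ f xs ≈ ∑ (λ x → k * f x) xs
  ∑-distribˡ k f []       = zeroʳ k
  ∑-distribˡ k f (x ∷ xs) = ≈-trans (distribˡ k _ _) (+-congˡ (∑-distribˡ k f xs))

  ∑-distribʳ : ∀ k (f : A → C) xs → ∑ f xs * k ≈ ∑ (λ x → f x * k) xs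
  ∑-distribʳ k f xs =
    ≈-trans (*-comm _ k) (≈-trans (∑-distribˡ k f xs) (Sum.fold-cong xs (λ x → *-comm k (f x))))

  pow-cong : ∀ {x y} k → x ≈ y → pow R x k ≈ pow R y k
  pow-cong zero    x≈y = ≈-refl
  pow-cong (suc k) x≈y = *-cong x≈y (pow-cong k x≈y)

  pow-length-filter : ∀ {Q : A → Set p} (Q? : ∀ y → Dec (Q y)) x xs →
                      pow R x (length (filter Q? xs)) ≈ ∏ (λ y → guard* (Q? y) x) xs
  pow-length-filter Q? x []       = ≈-refl
  pow-length-filter Q? x (y ∷ xs) with Q? y
  ... | yes _ = *-congˡ (pow-length-filter Q? x xs)
  ... | no  _ = ≈-trans (pow-length-filter Q? x xs) (≈-sym (*-identityˡ _))

  ∏ᶠ : (k : ℕ) → (Fin k → C) → C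
  ∏ᶠ zero    f = 1#
  ∏ᶠ (suc k) f = f zero * ∏ᶠ k (f ∘ suc)

  ∏-allFin : ∀ k (f : Fin k → C) → ∏ f (allFin k) ≈ ∏ᶠ k f
  ∏-allFin zero    f = ≈-refl
  ∏-allFin (suc k) f = ≈-trans (reflexive (Prod.fold-allFin-suc k f)) (*-congˡ (∏-allFin k (f ∘ suc)))

  ∏ᶠ-cong : ∀ k {f g : Fin k → C} → (∀ i → f i ≈ g i) → ∏ᶠ k f ≈ ∏ᶠ k g
  ∏ᶠ-cong zero    f≈g = ≈-refl
  ∏ᶠ-cong (suc k) f≈g = *-cong (f≈g zero) (∏ᶠ-cong k (f≈g ∘ suc))

  ∏ᶠ-1 : ∀ k (f : Fin k → C) → (∀ i → f i ≈ 1#) → ∏ᶠ k f ≈ 1#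
  ∏ᶠ-1 zero    f f≈1 = ≈-refl
  ∏ᶠ-1 (suc k) f f≈1 = ≈-trans (*-cong (f≈1 zero) (∏ᶠ-1 k (f ∘ suc) (f≈1 ∘ suc))) (*-identityˡ _)

  module _ {k : ℕ} (B : Fin (suc k) → Set a) (bs : (t : Fin (suc k)) → List (B t)) where

    tailFuns : List ((t : Fin k) → B (suc t))
    tailFuns = dfuns k (B ∘ suc) (bs ∘ suc)

    ∑-dfuns-suc : (F : ((t : Fin (suc k)) → B t) → C) →
                  ∑ F (dfuns (suc k) B bs) ≈ ∑ (λ b → ∑ (λ g → F (consF {B = B} b g)) tailFuns) (bs zero)
    ∑-dfuns-suc F = ≈-trans (Sum.fold-concatMap F _ (bs zero))
      (Sum.fold-cong (bs zero) (λ b → reflexive (Sum.fold-map F (consF {B = B} b) tailFuns)))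

  ∑-dfuns-∏ᶠ : ∀ k (B : Fin k → Set a) (bs : (t : Fin k) → List (B t)) (h : (t : Fin k) → B t → C) →
               ∑ (λ g → ∏ᶠ k (λ t → h t (g t))) (dfuns k B bs) ≈ ∏ᶠ k (λ t → ∑ (h t) (bs t))
  ∑-dfuns-∏ᶠ zero    B bs h = +-identityʳ _
  ∑-dfuns-∏ᶠ (suc k) B bs h = begin
    ∑ (λ g → ∏ᶠ (suc k) (λ t → h t (g t))) (dfuns (suc k) B bs)       ≈⟨ ∑-dfuns-suc B bs _ ⟩
    ∑ (λ b → ∑ (λ g → h zero b * Rest g) D) (bs zero)                  ≈⟨ Sum.fold-cong (bs zero) (λ b → ≈-sym (∑-distribˡ (h zero b) _ D)) ⟩
    ∑ (λ b → h zero b * ∑ Rest D) (bs zero)                            ≈⟨ Sum.fold-cong (bs zero) (λ b → *-congˡ (∑-dfuns-∏ᶠ k _ _ (h ∘ suc))) ⟩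
    ∑ (λ b → h zero b * ∏ᶠ k (λ t → ∑ (h (suc t)) (bs (suc t)))) (bs zero) ≈⟨ ≈-sym (∑-distribʳ _ (h zero) (bs zero)) ⟩
    ∏ᶠ (suc k) (λ t → ∑ (h t) (bs t))                                  ∎
    where
      D = tailFuns B bs
      Rest : ((t : Fin k) → B (suc t)) → C
      Rest g = ∏ᶠ k (λ t → h (suc t) (g t))

  ∑-dfuns-pushforward :
    ∀ {b r} k (B : Fin k → Set a) (bs : (t : Fin k) → List (B t))
    (B′ : Fin k → Set b) (bs′ : (t : Fin k) → List (B′ t))
    (_∼_ : ∀ {t} → B′ t → B′ t → Set r) (∼-refl : ∀ {t} (y : B′ t) → y ∼ y)
    (push : (t : Fin k) → B t → B′ t) (μ : (t : Fin k) → B t → C) (ν : (t : Fin k) → B′ t → C) →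
    (∀ t (G : B′ t → C) → (∀ {y y′} → y ∼ y′ → G y ≈ G y′) →
       ∑ (λ x → μ t x * G (push t x)) (bs t) ≈ ∑ (λ y → ν t y * G y) (bs′ t)) →
    (F : ((t : Fin k) → B′ t) → C) → (∀ {g g′} → (∀ t → g t ∼ g′ t) → F g ≈ F g′) →
    ∑ (λ g → ∏ᶠ k (λ t → μ t (g t)) * F (λ t → push t (g t))) (dfuns k B bs)
      ≈ ∑ (λ g → ∏ᶠ k (λ t → ν t (g t)) * F g) (dfuns k B′ bs′)
  ∑-dfuns-pushforward zero B bs B′ bs′ _∼_ ∼-refl push μ ν pushes F F-resp =
    +-congʳ (*-congˡ (F-resp λ ()))
  ∑-dfuns-pushforward (suc k) B bs B′ bs′ _∼_ ∼-refl push μ ν pushes F F-resp = begin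
    ∑ (λ g → ∏ᶠ (suc k) (λ t → μ t (g t)) * F (λ t → push t (g t))) (dfuns (suc k) B bs)
      ≈⟨ ∑-dfuns-suc B bs _ ⟩
    ∑ (λ x → ∑ (λ g → (μ zero x * Μ g) * F (λ t → push t (consF {B = B} x g t))) D) (bs zero)
      ≈⟨ Sum.fold-cong (bs zero) (λ x → ≈-trans
           (Sum.fold-cong D (λ g → ≈-trans (*-assoc _ _ _) (*-congˡ (*-congˡ (F-resp (push-cons x g))))))
           (≈-sym (∑-distribˡ (μ zero x) _ D))) ⟩
    ∑ (λ x → μ zero x * ∑ (λ g → Μ g * F (consF {B = B′} (push zero x) (λ t → push (suc t) (g t)))) D) (bs zero)
      ≈⟨ Sum.fold-cong (bs zero) (λ x → *-congˡ
           (∑-dfuns-pushforward k (B ∘ suc) (bs ∘ suc) (B′ ∘ suc) (bs′ ∘ suc) _∼_ ∼-refl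
              (push ∘ suc) (μ ∘ suc) (ν ∘ suc) (pushes ∘ suc)
              (λ g′ → F (consF {B = B′} (push zero x) g′)) (λ g∼g′ → F-resp (cons-∼ g∼g′)))) ⟩
    ∑ (λ x → μ zero x * G (push zero x)) (bs zero)
      ≈⟨ pushes zero G G-resp ⟩
    ∑ (λ y → ν zero y * G y) (bs′ zero)
      ≈⟨ Sum.fold-cong (bs′ zero) (λ y →
           ≈-trans (∑-distribˡ (ν zero y) _ D′) (Sum.fold-cong D′ (λ g → ≈-sym (*-assoc _ _ _)))) ⟩
    ∑ (λ y → ∑ (λ g → (ν zero y * Ν g) * F (consF {B = B′} y g)) D′) (bs′ zero)
      ≈⟨ ≈-sym (∑-dfuns-suc B′ bs′ _) ⟩
    ∑ (λ g → ∏ᶠ (suc k) (λ t → ν t (g t)) * F g) (dfuns (suc k) B′ bs′) ∎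
    where
      D  = tailFuns B bs
      D′ = tailFuns B′ bs′
      Μ : ((t : Fin k) → B (suc t)) → C
      Μ g = ∏ᶠ k (λ t → μ (suc t) (g t))
      Ν : ((t : Fin k) → B′ (suc t)) → C
      Ν g = ∏ᶠ k (λ t → ν (suc t) (g t))
      push-cons : ∀ x g t → push t (consF {B = B} x g t) ∼ consF {B = B′} (push zero x) (λ t → push (suc t) (g t)) t
      push-cons x g zero    = ∼-refl _
      push-cons x g (suc t) = ∼-refl _
      cons-∼ : ∀ {y} {g g′ : (t : Fin k) → B′ (suc t)} → (∀ t → g t ∼ g′ t) →
               ∀ t → consF {B = B′} y g t ∼ consF {B = B′} y g′ t
      cons-∼ g∼g′ zero    = ∼-refl _
      cons-∼ g∼g′ (suc t) = g∼g′ t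
      G : B′ zero → C
      G y = ∑ (λ g → Ν g * F (consF {B = B′} y g)) D′
      G-resp : ∀ {y y′} → y ∼ y′ → G y ≈ G y′
      G-resp y∼y′ = Sum.fold-cong D′ (λ g → *-congˡ (F-resp (λ { zero → y∼y′ ; (suc t) → ∼-refl _ })))

  ∑-funs-marginal : ∀ (L : List A) m (r : Fin m) (h : Fin m → A → C) (K : A → C) →
                    (∀ i → i ≢ r → ∑ (h i) L ≈ 1#) →
                    ∑ (λ g → ∏ᶠ m (λ i → h i (g i)) * K (g r)) (funs m L) ≈ ∑ (λ x → h r x * K x) L
  ∑-funs-marginal L (suc m) zero h K total≈1 = begin
    ∑ (λ g → ∏ᶠ (suc m) (λ i → h i (g i)) * K (g zero)) (funs (suc m) L)
      ≈⟨ ∑-dfuns-suc (λ _ → _) (λ _ → L) _ ⟩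
    ∑ (λ x → ∑ (λ g → (h zero x * Rest g) * K x) D) L
      ≈⟨ Sum.fold-cong L (λ x → ≈-trans
           (Sum.fold-cong D (λ g → ≈-trans (*-assoc _ _ _) (≈-trans (*-congˡ (*-comm _ _)) (≈-sym (*-assoc _ _ _)))))
           (≈-sym (∑-distribˡ _ Rest D))) ⟩
    ∑ (λ x → (h zero x * K x) * ∑ Rest D) L
      ≈⟨ Sum.fold-cong L (λ x → ≈-trans (*-congˡ (≈-trans (∑-dfuns-∏ᶠ m (λ _ → _) (λ _ → L) (h ∘ suc))
                                                 (∏ᶠ-1 m _ (λ i → total≈1 (suc i) λ ()))))
                                        (*-identityʳ _)) ⟩
    ∑ (λ x → h zero x * K x) L ∎
    where
      D = funs m L
      Rest : (Fin m → _) → C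
      Rest g = ∏ᶠ m (λ i → h (suc i) (g i))
  ∑-funs-marginal L (suc m) (suc r) h K total≈1 = begin
    ∑ (λ g → ∏ᶠ (suc m) (λ i → h i (g i)) * K (g (suc r))) (funs (suc m) L)
      ≈⟨ ∑-dfuns-suc (λ _ → _) (λ _ → L) _ ⟩
    ∑ (λ x → ∑ (λ g → (h zero x * Rest g) * K (g r)) D) L
      ≈⟨ Sum.fold-cong L (λ x → ≈-trans (Sum.fold-cong D (λ g → *-assoc _ _ _)) (≈-sym (∑-distribˡ _ _ D))) ⟩
    ∑ (λ x → h zero x * ∑ (λ g → Rest g * K (g r)) D) L
      ≈⟨ Sum.fold-cong L (λ x → *-congˡ
           (∑-funs-marginal L m r (h ∘ suc) K (λ i i≢r → total≈1 (suc i) (i≢r ∘ suc-injective)))) ⟩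
    ∑ (λ x → h zero x * ∑ (λ y → h (suc r) y * K y) L) L
      ≈⟨ ≈-sym (∑-distribʳ _ _ L) ⟩
    ∑ (h zero) L * ∑ (λ y → h (suc r) y * K y) L
      ≈⟨ ≈-trans (*-congʳ (total≈1 zero λ ())) (*-identityˡ _) ⟩
    ∑ (λ y → h (suc r) y * K y) L ∎
    where
      D = funs m L
      Rest : (Fin m → _) → C
      Rest g = ∏ᶠ m (λ i → h (suc i) (g i))

data Terminates {V : Set} (p : V → Maybe V) : Maybe V → Set where
  done : Terminates p nothing
  step : ∀ {v} → Terminates p (p v) → Terminates p (just v)

Acyclic : {V : Set} → (V → Maybe V) → Set
Acyclic p = ∀ v → Terminates p (just v)

module Acyclicity {V : Set} where

  Terminates-resp : {p q : V → Maybe V} → p ≗ q → ∀ {m} → Terminates p m → Terminates q m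
  Terminates-resp p≗q done = done
  Terminates-resp {q = q} p≗q (step {v} t) = step (subst (Terminates q) (p≗q v) (Terminates-resp p≗q t))

  Acyclic-resp : {p q : V → Maybe V} → p ≗ q → Acyclic p → Acyclic q
  Acyclic-resp p≗q acyclic v = Terminates-resp p≗q (acyclic v)

  selfLoop⇒¬Terminates : (p : V → Maybe V) (v : V) → p v ≡ just v → ¬ Terminates p (just v)
  selfLoop⇒¬Terminates p v loop t = go t refl
    where
      go : ∀ {m} → Terminates p m → m ≢ just v
      go done     ()
      go (step t) refl = go t loop

  module Iterate (p : V → Maybe V) where

    up : Maybe V → Maybe V
    up nothing  = nothing
    up (just w) = p w

    iterate : ℕ → Maybe V → Maybe V
    iterate zero    m = m
    iterate (suc k) m = up (iterate k m)

    iterParent≡iterate : ∀ k v → iterParent p k v ≡ iterate k (just v)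
    iterParent≡iterate zero    v = refl
    iterParent≡iterate (suc k) v with iterParent p k v | iterParent≡iterate k v
    ... | nothing | eq = cong up eq
    ... | just w  | eq = cong up eq

    iterate-suc : ∀ k m → iterate (suc k) m ≡ iterate k (up m)
    iterate-suc zero    m = refl
    iterate-suc (suc k) m = cong up (iterate-suc k m)

    iterate≡nothing⇒Terminates : ∀ k m → iterate k m ≡ nothing → Terminates p m
    iterate≡nothing⇒Terminates zero .nothing refl = done
    iterate≡nothing⇒Terminates (suc k) m eq
      with iterate≡nothing⇒Terminates k (up m) (trans (sym (iterate-suc k m)) eq)
    iterate≡nothing⇒Terminates (suc k) nothing  eq | t = done
    iterate≡nothing⇒Terminates (suc k) (just w) eq | t = step t

    depth : ∀ {m} → Terminates p m → ℕ
    depth done     = 0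
    depth (step t) = suc (depth t)

    depth-unique : ∀ {m} (t t′ : Terminates p m) → depth t ≡ depth t′
    depth-unique done     done      = refl
    depth-unique (step t) (step t′) = cong suc (depth-unique t t′)

    module Height (acyclic : Acyclic p) where

      height : Maybe V → ℕ
      height nothing  = 0
      height (just v) = depth (acyclic v)

      height≡depth : ∀ {m} (t : Terminates p m) → height m ≡ depth t
      height≡depth done = refl
      height≡depth {just v} t = depth-unique (acyclic v) t

      height-just : ∀ v → height (just v) ≡ suc (height (p v))
      height-just v with acyclic v
      ... | step t = cong suc (sym (height≡depth t))

      height-up : ∀ m → height (up m) ≡ height m ∸ 1
      height-up nothing  = refl
      height-up (just w) = cong (_∸ 1) (sym (height-just w))

      height-iterate : ∀ k m → height (iterate k m) ≡ height m ∸ k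
      height-iterate zero    m = refl
      height-iterate (suc k) m = trans (height-up (iterate k m)) (trans (cong (_∸ 1) (height-iterate k m))
        (trans (ℕ.∸-+-assoc (height m) k 1) (cong (height m ∸_) (ℕ.+-comm k 1))))

      -- The ancestors of v at distances 0 … height v - 1 are distinct vertices (their heights
      -- differ), so there are at most |vs| of them.
      module _ (vs : List V) (complete : ∀ v → v ∈ vs) where

        index : V → Fin (length vs)
        index v = Any.index (complete v)

        index-injective : ∀ {v w} → index v ≡ index w → v ≡ w
        index-injective {v} {w} eq =
          trans (lookup-index (complete v)) (trans (cong (lookup vs) eq) (sym (lookup-index (complete w))))

        ancestor : ∀ v j → j < height (just v) → Σ V (λ w → iterate j (just v) ≡ just w)
        ancestor v j j< with iterate j (just v) in eq
        ... | just w  = w , refl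
        ... | nothing = ⊥-elim (ℕ.m>n⇒m∸n≢0 j< (trans (sym (height-iterate j (just v))) (cong height eq)))

        height≤length : ∀ v → height (just v) ≤ length vs
        height≤length v = injective⇒≤ {f = index ∘ anc} injective
          where
            anc : Fin (height (just v)) → V
            anc j = proj₁ (ancestor v (toℕ j) (toℕ<n j))
            height-anc : ∀ j → height (just (anc j)) ≡ height (just v) ∸ toℕ j
            height-anc j with ancestor v (toℕ j) (toℕ<n j)
            ... | w , eq = trans (cong height (sym eq)) (height-iterate (toℕ j) (just v))
            injective : ∀ {i j} → index (anc i) ≡ index (anc j) → i ≡ j
            injective {i} {j} eq = toℕ-injective (ℕ.∸-cancelˡ-≡ (ℕ.<⇒≤ (toℕ<n i)) (ℕ.<⇒≤ (toℕ<n j))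
              (trans (sym (height-anc i)) (trans (cong (λ u → height (just u)) (index-injective eq)) (height-anc j))))

        iterate-length≡nothing : ∀ v → iterate (length vs) (just v) ≡ nothing
        iterate-length≡nothing v with iterate (length vs) (just v) in eq
        ... | nothing = refl
        ... | just w  = ⊥-elim (ℕ.<⇒≱ 0<height (ℕ.≤-reflexive (trans (sym (cong height eq))
                          (trans (height-iterate (length vs) (just v)) (ℕ.m≤n⇒m∸n≡0 (height≤length v))))))
          where
            0<height : 0 < height (just w)
            0<height rewrite height-just w = s≤s z≤n

  module _ (vs : List V) (complete : ∀ v → v ∈ vs) where
    open Iterate

    IsForest⇒Acyclic : (p : V → Maybe V) → IsForest vs p → Acyclic p
    IsForest⇒Acyclic p forest v = iterate≡nothing⇒Terminates p (length vs) (just v)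
      (trans (sym (iterParent≡iterate p (length vs) v)) (T-is-nothing (All.lookup forest (complete v))))
      where
        T-is-nothing : ∀ {m : Maybe V} → T (is-nothing m) → m ≡ nothing
        T-is-nothing {nothing} _ = refl

    Acyclic⇒IsForest : (p : V → Maybe V) → Acyclic p → IsForest vs p
    Acyclic⇒IsForest p acyclic = All.tabulate λ {v} _ → subst (λ m → T (is-nothing m))
      (sym (trans (iterParent≡iterate p (length vs) v) (Height.iterate-length≡nothing p acyclic vs complete v))) tt

    isForest?-cong : {p q : V → Maybe V} → (Acyclic p → Acyclic q) → (Acyclic q → Acyclic p) →
                     does (isForest? vs p) ≡ does (isForest? vs q)
    isForest?-cong {p} {q} p⇒q q⇒p = does-⇔
      (mk⇔ (λ f → Acyclic⇒IsForest q (p⇒q (IsForest⇒Acyclic p f)))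
           (λ f → Acyclic⇒IsForest p (q⇒p (IsForest⇒Acyclic q f))))
      (isForest? vs p) (isForest? vs q)

concatMap-unique : ∀ (key : B → A) (f : A → List B) xs → Unique xs → (∀ x → Unique (f x)) →
                   (∀ x {y} → y ∈ f x → key y ≡ x) → Unique (concatMap f xs)
concatMap-unique key f []       _          uf key-f = []
concatMap-unique key f (x ∷ xs) (x∉ ∷ uxs) uf key-f =
  Unique.++⁺ (uf x) (concatMap-unique key f xs uxs uf key-f) disjoint
  where
    disjoint : ∀ {y} → ¬ (y ∈ f x × y ∈ concatMap f xs)
    disjoint {y} (y∈fx , y∈rest) = go xs x∉ (∈-concatMap⁻ f {xs = xs} y∈rest)
      where
        go : ∀ zs → All (x ≢_) zs → Any (λ z → y ∈ f z) zs → ⊥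
        go (z ∷ zs) (x≢z ∷ _)   (here y∈fz) = x≢z (trans (sym (key-f x y∈fx)) (key-f z y∈fz))
        go (z ∷ zs) (_   ∷ x∉) (there any)  = go zs x∉ any

length-filter-except : ∀ {Q : A → Set p} (Q? : ∀ y → Dec (Q y)) xs {b} → Unique xs → b ∈ xs →
                       (∀ y → Q y → y ≢ b) → (∀ y → y ≢ b → Q y) → length (filter Q? xs) ≡ length xs ∸ 1
length-filter-except Q? (y ∷ ys) (y∉ ∷ _) (here refl) Q⇒≢ ≢⇒Q =
  trans (cong length (filter-reject Q? (λ Qy → Q⇒≢ y Qy refl)))
        (cong length (filter-all Q? (All.map (λ y≢y′ → ≢⇒Q _ (y≢y′ ∘ sym)) y∉)))
length-filter-except Q? (y ∷ ys) (y∉ ∷ u) (there b∈) Q⇒≢ ≢⇒Q with Q? y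
... | no  ¬Qy = ⊥-elim (¬Qy (≢⇒Q y λ { refl → All.lookup y∉ b∈ refl }))
... | yes _ with ys | b∈ | length-filter-except Q? ys u b∈ Q⇒≢ ≢⇒Q
...   | _ ∷ _ | _ | eq = cong suc eq

module ParentMapSums {c ℓ} (R : CommutativeSemiring c ℓ) (d : ℕ) (n : Fin d → ℕ) where
  open CommutativeSemiring R
    renaming (Carrier to C; refl to ≈-refl; sym to ≈-sym; trans to ≈-trans; zero to *-zero)
  open import Relation.Binary.Reasoning.Setoid setoid
  open SemiringSums R public

  V : Set
  V = Vertex d n

  vs : List V
  vs = vertices d n

  targets : List (Maybe V)
  targets = nothing ∷ map just vs

  _≟M_ : DecidableEquality (Maybe V)
  _≟M_ = Maybe-≡-dec _≟V_

  ∈-vertices : ∀ v → v ∈ vs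
  ∈-vertices (t , i) = ∈-concatMap⁺ (λ t → map (t ,_) (allFin (n t)))
    (Any.map (λ { refl → ∈-map⁺ (t ,_) (∈-allFin i) }) (∈-allFin t))

  vertices-unique : Unique vs
  vertices-unique = concatMap-unique proj₁ (λ t → map (t ,_) (allFin (n t))) (allFin d) (Unique.allFin⁺ d)
    (λ t → Unique.map⁺ (λ { refl → refl }) (Unique.allFin⁺ (n t))) type-of
    where
      type-of : ∀ t {y} → y ∈ map (t ,_) (allFin (n t)) → proj₁ y ≡ t
      type-of t y∈ with ∈-map⁻ (t ,_) y∈
      ... | i , _ , refl = refl

  ∈-targets : ∀ m → m ∈ targets
  ∈-targets nothing  = here refl
  ∈-targets (just v) = there (∈-map⁺ just (∈-vertices v))

  targets-unique : Unique targets
  targets-unique = All.tabulate nothing∉ ∷ Unique.map⁺ just-injective vertices-unique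
    where
      nothing∉ : ∀ {m} → m ∈ map just vs → nothing ≢ m
      nothing∉ m∈ eq with ∈-map⁻ just m∈
      nothing∉ m∈ () | _ , _ , refl

  ParentMapᶜ : Set
  ParentMapᶜ = (t : Fin d) → Fin (n t) → Maybe V

  curriedParentMaps : List ParentMapᶜ
  curriedParentMaps = dfuns d (λ t → Fin (n t) → Maybe V) (λ t → funs (n t) targets)

  uncurry : ParentMapᶜ → ParentMap d n
  uncurry g v = g (proj₁ v) (proj₂ v)

  ∑maps : (ParentMap d n → C) → C
  ∑maps F = ∑ F (allParentMaps d n)

  ∑maps-curried : ∀ F → ∑maps F ≡ ∑ (F ∘ uncurry) curriedParentMaps
  ∑maps-curried F = Sum.fold-map F uncurry curriedParentMaps

  ∑maps-cong : ∀ {F G} → (∀ p → F p ≈ G p) → ∑maps F ≈ ∑maps G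
  ∑maps-cong = Sum.fold-cong (allParentMaps d n)

  -- w u t is the weight of vertex u choosing t as its parent (t = nothing: u is a root).
  Weight : Set c
  Weight = V → Maybe V → C

  weight : Weight → ParentMap d n → C
  weight w p = ∏ (λ u → w u (p u)) vs

  weight-cong : ∀ {w w′} → (∀ u t → w u t ≈ w′ u t) → ∀ p → weight w p ≈ weight w′ p
  weight-cong w≈w′ p = Prod.fold-cong vs (λ u → w≈w′ u (p u))

  ∑-vertices : (f : V → C) → ∑ f vs ≈ ∑ (λ t → ∑ (λ i → f (t , i)) (allFin (n t))) (allFin d)
  ∑-vertices f = ≈-trans (Sum.fold-concatMap f (λ t → map (t ,_) (allFin (n t))) (allFin d))
    (Sum.fold-cong (allFin d) (λ t → reflexive (Sum.fold-map f (t ,_) (allFin (n t)))))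

  ∏-vertices : (f : V → C) → ∏ f vs ≈ ∏ (λ t → ∏ (λ i → f (t , i)) (allFin (n t))) (allFin d)
  ∏-vertices f = ≈-trans (Prod.fold-concatMap f (λ t → map (t ,_) (allFin (n t))) (allFin d))
    (Prod.fold-cong (allFin d) (λ t → reflexive (Prod.fold-map f (t ,_) (allFin (n t)))))

  weight-∏ᶠ : ∀ w p → weight w p ≈ ∏ᶠ d (λ t → ∏ᶠ (n t) (λ i → w (t , i) (p (t , i))))
  weight-∏ᶠ w p = begin
    weight w p                                                 ≈⟨ ∏-vertices _ ⟩
    ∏ (λ t → ∏ (λ i → w (t , i) (p (t , i))) (allFin (n t))) (allFin d)
      ≈⟨ Prod.fold-cong (allFin d) (λ t → ∏-allFin (n t) _) ⟩
    ∏ (λ t → ∏ᶠ (n t) (λ i → w (t , i) (p (t , i)))) (allFin d) ≈⟨ ∏-allFin d _ ⟩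
    ∏ᶠ d (λ t → ∏ᶠ (n t) (λ i → w (t , i) (p (t , i))))        ∎

  ∑maps-weight : ∀ w → ∑maps (weight w) ≈ ∏ (λ u → ∑ (w u) targets) vs
  ∑maps-weight w = begin
    ∑maps (weight w)                                                     ≡⟨ ∑maps-curried _ ⟩
    ∑ (λ g → weight w (uncurry g)) curriedParentMaps                    ≈⟨ Sum.fold-cong curriedParentMaps (λ g → weight-∏ᶠ w (uncurry g)) ⟩
    ∑ (λ g → ∏ᶠ d (λ t → ∏ᶠ (n t) (λ i → w (t , i) (g t i)))) curriedParentMaps
      ≈⟨ ∑-dfuns-∏ᶠ d _ (λ t → funs (n t) targets) (λ t g → ∏ᶠ (n t) (λ i → w (t , i) (g i))) ⟩
    ∏ᶠ d (λ t → ∑ (λ g → ∏ᶠ (n t) (λ i → w (t , i) (g i))) (funs (n t) targets))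
      ≈⟨ ∏ᶠ-cong d (λ t → ∑-dfuns-∏ᶠ (n t) _ (λ _ → targets) (λ i → w (t , i))) ⟩
    ∏ᶠ d (λ t → ∏ᶠ (n t) (λ i → ∑ (w (t , i)) targets))                  ≈⟨ ≈-sym (weight-∏ᶠ (λ u _ → ∑ (w u) targets) (λ _ → nothing)) ⟩
    ∏ (λ u → ∑ (w u) targets) vs                                         ∎

  ∑maps-pushforward : (push : V → Maybe V → Maybe V) (μ ν : Weight) →
    (∀ u (G : Maybe V → C) → ∑ (λ t → μ u t * G (push u t)) targets ≈ ∑ (λ t → ν u t * G t) targets) →
    (F : ParentMap d n → C) → (∀ {p q} → p ≗ q → F p ≈ F q) →
    ∑maps (λ p → weight μ p * F (λ u → push u (p u))) ≈ ∑maps (λ p → weight ν p * F p)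
  ∑maps-pushforward push μ ν pushes F F-resp = begin
    ∑maps (λ p → weight μ p * F (λ u → push u (p u)))                     ≡⟨ ∑maps-curried _ ⟩
    ∑ (λ g → weight μ (uncurry g) * F (λ u → push u (uncurry g u))) curriedParentMaps
      ≈⟨ Sum.fold-cong curriedParentMaps (λ g → *-congʳ (weight-∏ᶠ μ (uncurry g))) ⟩
    ∑ (λ g → ∏ᶠ d (λ t → ∏ᶠ (n t) (λ i → μ (t , i) (g t i))) * F (λ u → push u (uncurry g u))) curriedParentMaps
      ≈⟨ ∑-dfuns-pushforward d Row (λ t → funs (n t) targets) Row (λ t → funs (n t) targets)
           (λ g g′ → ∀ i → g i ≡ g′ i) (λ _ _ → refl)
           (λ t g i → push (t , i) (g i)) (λ t g → ∏ᶠ (n t) (λ i → μ (t , i) (g i)))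
           (λ t g → ∏ᶠ (n t) (λ i → ν (t , i) (g i))) pushes-row
           (F ∘ uncurry) (λ g∼g′ → F-resp (λ u → g∼g′ (proj₁ u) (proj₂ u))) ⟩
    ∑ (λ g → ∏ᶠ d (λ t → ∏ᶠ (n t) (λ i → ν (t , i) (g t i))) * F (uncurry g)) curriedParentMaps
      ≈⟨ Sum.fold-cong curriedParentMaps (λ g → *-congʳ (≈-sym (weight-∏ᶠ ν (uncurry g)))) ⟩
    ∑ (λ g → weight ν (uncurry g) * F (uncurry g)) curriedParentMaps        ≡⟨ sym (∑maps-curried _) ⟩
    ∑maps (λ p → weight ν p * F p)                                         ∎
    where
      Row : Fin d → Set
      Row t = Fin (n t) → Maybe V
      pushes-row : ∀ t (G : Row t → C) → (∀ {g g′} → (∀ i → g i ≡ g′ i) → G g ≈ G g′) →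
        ∑ (λ g → ∏ᶠ (n t) (λ i → μ (t , i) (g i)) * G (λ i → push (t , i) (g i))) (funs (n t) targets)
          ≈ ∑ (λ g → ∏ᶠ (n t) (λ i → ν (t , i) (g i)) * G g) (funs (n t) targets)
      pushes-row t G G-resp = ∑-dfuns-pushforward (n t) (λ _ → Maybe V) (λ _ → targets) (λ _ → Maybe V) (λ _ → targets)
        _≡_ (λ _ → refl) (λ i → push (t , i)) (λ i → μ (t , i)) (λ i → ν (t , i))
        (λ i G′ _ → pushes (t , i) G′) G G-resp

module Contraction {c ℓ} (R : CommutativeSemiring c ℓ) (d : ℕ) (n : Fin d → ℕ) where
  open CommutativeSemiring R
    renaming (Carrier to C; refl to ≈-refl; sym to ≈-sym; trans to ≈-trans; zero to *-zero)
  open import Relation.Binary.Reasoning.Setoid setoid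
  open ParentMapSums R d n public
  open Acyclicity

  forest𝟙 : ParentMap d n → C
  forest𝟙 p = 𝟙 (isForest? vs p)

  forest𝟙-cong : ∀ {p q} → (Acyclic p → Acyclic q) → (Acyclic q → Acyclic p) → forest𝟙 p ≡ forest𝟙 q
  forest𝟙-cong p⇒q q⇒p = cong (λ b → if b then 1# else 0#) (isForest?-cong vs ∈-vertices p⇒q q⇒p)

  forest𝟙-resp : ∀ {p q} → p ≗ q → forest𝟙 p ≈ forest𝟙 q
  forest𝟙-resp p≗q = reflexive (forest𝟙-cong (Acyclic-resp p≗q) (Acyclic-resp (sym ∘ p≗q)))

  forest𝟙-cyclic : ∀ {p} → ¬ Acyclic p → forest𝟙 p ≡ 0#
  forest𝟙-cyclic {p} ¬acyclic = 𝟙-no (isForest? vs p) (¬acyclic ∘ IsForest⇒Acyclic vs ∈-vertices p)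

  forest𝟙-acyclic : ∀ {p} → Acyclic p → forest𝟙 p ≡ 1#
  forest𝟙-acyclic {p} acyclic = 𝟙-yes (isForest? vs p) (Acyclic⇒IsForest vs ∈-vertices p acyclic)

  forestSum : Weight → C
  forestSum w = ∑maps (λ p → weight w p * forest𝟙 p)

  forestSum-cong : ∀ {w w′} → (∀ u t → w u t ≈ w′ u t) → forestSum w ≈ forestSum w′
  forestSum-cong w≈w′ = ∑maps-cong (λ p → *-congʳ (weight-cong w≈w′ p))

  𝟙-refl : ∀ m → 𝟙 (m ≟M m) ≡ 1#
  𝟙-refl m = 𝟙-yes (m ≟M m) refl

  𝟙* : ∀ {m m′} (x : C) → m ≢ m′ → 𝟙 (m ≟M m′) * x ≈ 0#
  𝟙* {m} {m′} x m≢m′ = ≈-trans (*-congʳ (reflexive (𝟙-no (m ≟M m′) m≢m′))) (zeroˡ x)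

  𝟙-sym : ∀ m m′ → 𝟙 (m ≟M m′) ≡ 𝟙 (m′ ≟M m)
  𝟙-sym m m′ with m ≟M m′ | m′ ≟M m
  ... | yes _    | yes _    = refl
  ... | no  _    | no  _    = refl
  ... | yes m≡m′ | no  m′≢m = ⊥-elim (m′≢m (sym m≡m′))
  ... | no  m≢m′ | yes m′≡m = ⊥-elim (m≢m′ (sym m′≡m))

  ∑-𝟙* : ∀ m (f : Maybe V → C) → ∑ (λ t → 𝟙 (t ≟M m) * f t) targets ≈ f m
  ∑-𝟙* m f = ≈-trans (Sum.fold-pick _≟M_ _ targets-unique (∈-targets m) (λ t _ t≢m → 𝟙* (f t) t≢m))
                     (≈-trans (*-congʳ (reflexive (𝟙-refl m))) (*-identityˡ _))

  module _ (v : V) (a : Maybe V) where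

    retarget : Maybe V → Maybe V
    retarget x with x ≟M just v
    ... | yes _ = a
    ... | no  _ = x

    retarget-v : retarget (just v) ≡ a
    retarget-v with just v ≟M just v
    ... | yes _   = refl
    ... | no  v≢v = ⊥-elim (v≢v refl)

    retarget-≢ : ∀ x → x ≢ just v → retarget x ≡ x
    retarget-≢ x x≢v with x ≟M just v
    ... | yes x≡v = ⊥-elim (x≢v x≡v)
    ... | no  _   = refl

    contractMap : V → Maybe V → Maybe V
    contractMap u x with u ≟V v
    ... | yes _ = nothing
    ... | no  _ = retarget x

    contractMap-v : ∀ x → contractMap v x ≡ nothing
    contractMap-v x with v ≟V v
    ... | yes _   = refl
    ... | no  v≢v = ⊥-elim (v≢v refl)

    contractMap-≢ : ∀ u x → u ≢ v → contractMap u x ≡ retarget x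
    contractMap-≢ u x u≢v with u ≟V v
    ... | yes u≡v = ⊥-elim (u≢v u≡v)
    ... | no  _   = refl

    module _ (w : Weight) where

      forceParent : Weight
      forceParent u x with u ≟V v
      ... | yes _ = 𝟙 (x ≟M a) * w u x
      ... | no  _ = w u x

      redirectedRow : V → Maybe V → C
      redirectedRow u t = if does (t ≟M just v) then 0# else w u t + 𝟙 (t ≟M a) * w u (just v)

      -- v becomes an isolated root; an edge u → v of weight w u (just v) becomes an edge u → a.
      contract : Weight
      contract u t with u ≟V v
      ... | yes _ = 𝟙 (t ≟M nothing)
      ... | no  _ = redirectedRow u t

      contractScaled : Weight
      contractScaled u t with u ≟V v
      ... | yes _ = w v a * 𝟙 (t ≟M nothing)
      ... | no  _ = redirectedRow u t

      forceParent-v : ∀ x → forceParent v x ≡ 𝟙 (x ≟M a) * w v x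
      forceParent-v x with v ≟V v
      ... | yes _   = refl
      ... | no  v≢v = ⊥-elim (v≢v refl)

      forceParent-≢ : ∀ u x → u ≢ v → forceParent u x ≡ w u x
      forceParent-≢ u x u≢v with u ≟V v
      ... | yes u≡v = ⊥-elim (u≢v u≡v)
      ... | no  _   = refl

      contract-v : ∀ t → contract v t ≡ 𝟙 (t ≟M nothing)
      contract-v t with v ≟V v
      ... | yes _   = refl
      ... | no  v≢v = ⊥-elim (v≢v refl)

      contract-≢ : ∀ u t → u ≢ v → contract u t ≡ redirectedRow u t
      contract-≢ u t u≢v with u ≟V v
      ... | yes u≡v = ⊥-elim (u≢v u≡v)
      ... | no  _   = refl

      contractScaled-v : ∀ t → contractScaled v t ≈ w v a * contract v t
      contractScaled-v t with v ≟V v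
      ... | yes _   = ≈-refl
      ... | no  v≢v = ⊥-elim (v≢v refl)

      contractScaled-≢ : ∀ u t → u ≢ v → contractScaled u t ≡ contract u t
      contractScaled-≢ u t u≢v = trans (scaled u≢v) (sym (contract-≢ u t u≢v))
        where
          scaled : u ≢ v → contractScaled u t ≡ redirectedRow u t
          scaled u≢v with u ≟V v
          ... | yes u≡v = ⊥-elim (u≢v u≡v)
          ... | no  _   = refl

    module _ (a≢v : a ≢ just v) where

      retarget≢v : ∀ x → retarget x ≢ just v
      retarget≢v x with x ≟M just v
      ... | yes _   = a≢v
      ... | no  x≢v = x≢v

      module _ (p : ParentMap d n) (pv≡a : p v ≡ a) where

        contracted : ParentMap d n
        contracted u = contractMap u (p u)

        forward : ∀ {m} → Terminates p m → Terminates contracted (retarget m)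
        forward done = subst (Terminates contracted) (sym (retarget-≢ nothing λ ())) done
        forward {just u} (step t) = via (u ≟V v) (forward t)
          where
            via : Dec (u ≡ v) → Terminates contracted (retarget (p u)) → Terminates contracted (retarget (just u))
            via (yes refl) r = subst (Terminates contracted) (sym retarget-v)
                                 (subst (Terminates contracted) (trans (cong retarget pv≡a) (retarget-≢ a a≢v)) r)
            via (no  u≢v)  r = subst (Terminates contracted) (sym (retarget-≢ (just u) (u≢v ∘ just-injective)))
                                 (step (subst (Terminates contracted) (sym (contractMap-≢ u (p u) u≢v)) r))

        contract-acyclic : Acyclic p → Acyclic contracted
        contract-acyclic acyclic u = via (u ≟V v)
          where
            via : Dec (u ≡ v) → Terminates contracted (just u)
            via (yes refl) = step (subst (Terminates contracted) (sym (contractMap-v (p v))) done)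
            via (no  u≢v)  = subst (Terminates contracted) (retarget-≢ (just u) (u≢v ∘ just-injective)) (forward (acyclic u))

        backward : ∀ {m} → Terminates contracted m → m ≢ just v → Terminates p m
        backward done _ = done
        backward {just u} (step t) u≢v′ = via (p u ≟M just v)
          where
            u≢v : u ≢ v
            u≢v = u≢v′ ∘ cong just
            t′ : Terminates p (contracted u)
            t′ = backward t (λ eq → retarget≢v (p u) (trans (sym (contractMap-≢ u (p u) u≢v)) eq))
            via : Dec (p u ≡ just v) → Terminates p (just u)
            via (yes pu≡v) = step (subst (Terminates p) (sym pu≡v) (step (subst (Terminates p) (sym pv≡a)
                               (subst (Terminates p) (trans (contractMap-≢ u (p u) u≢v)
                                                            (trans (cong retarget pu≡v) retarget-v)) t′))))
            via (no  pu≢v) = step (subst (Terminates p) (trans (contractMap-≢ u (p u) u≢v) (retarget-≢ (p u) pu≢v)) t′)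

        contract-acyclic⁻ : Acyclic contracted → Acyclic p
        contract-acyclic⁻ acyclic u = via (u ≟V v)
          where
            terminates : ∀ m → Terminates contracted m
            terminates nothing  = done
            terminates (just y) = acyclic y
            via : Dec (u ≡ v) → Terminates p (just u)
            via (yes refl) = step (subst (Terminates p) (sym pv≡a) (backward (terminates a) a≢v))
            via (no  u≢v)  = backward (acyclic u) (u≢v ∘ just-injective)

      forceParent-pushforward : ∀ (w : Weight) u (G : Maybe V → C) →
        ∑ (λ x → forceParent w u x * G (contractMap u x)) targets ≈ ∑ (λ y → contractScaled w u y * G y) targets
      forceParent-pushforward w u G with u ≟V v
      ... | yes refl = begin
        ∑ (λ x → (𝟙 (x ≟M a) * w v x) * G nothing) targets  ≈⟨ Sum.fold-cong targets (λ x → *-assoc _ _ _) ⟩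
        ∑ (λ x → 𝟙 (x ≟M a) * (w v x * G nothing)) targets   ≈⟨ ∑-𝟙* a _ ⟩
        w v a * G nothing                                      ≈⟨ ≈-sym (∑-𝟙* nothing (λ y → w v a * G y)) ⟩
        ∑ (λ y → 𝟙 (y ≟M nothing) * (w v a * G y)) targets     ≈⟨ Sum.fold-cong targets (λ y → ≈-trans (≈-sym (*-assoc _ _ _)) (*-congʳ (*-comm _ _))) ⟩
        ∑ (λ y → (w v a * 𝟙 (y ≟M nothing)) * G y) targets     ∎
      ... | no  u≢v  = begin
        ∑ (λ x → w u x * G (retarget x)) targets
          ≈⟨ Sum.fold-extract _≟M_ _ targets-unique (∈-targets (just v)) ⟩
        w u (just v) * G (retarget (just v)) + ∑ (Sum.without _≟M_ (just v) (λ x → w u x * G (retarget x))) targets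
          ≈⟨ +-cong (*-congˡ (reflexive (cong G retarget-v))) (Sum.fold-cong targets (λ x → away x (x ≟M just v))) ⟩
        w u (just v) * G a + ∑ (Sum.without _≟M_ (just v) (λ x → w u x * G x)) targets
          ≈⟨ +-comm _ _ ⟩
        ∑ (Sum.without _≟M_ (just v) (λ x → w u x * G x)) targets + w u (just v) * G a
          ≈⟨ +-congˡ (≈-sym (∑-𝟙* a (λ y → w u (just v) * G y))) ⟩
        ∑ (Sum.without _≟M_ (just v) (λ x → w u x * G x)) targets + ∑ (λ y → 𝟙 (y ≟M a) * (w u (just v) * G y)) targets
          ≈⟨ ≈-sym (Sum.fold-∙ _ _ targets) ⟩
        ∑ (λ y → Sum.without _≟M_ (just v) (λ x → w u x * G x) y + 𝟙 (y ≟M a) * (w u (just v) * G y)) targets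
          ≈⟨ Sum.fold-cong targets (λ y → collect y (y ≟M just v)) ⟩
        ∑ (λ y → (if does (y ≟M just v) then 0# else w u y + 𝟙 (y ≟M a) * w u (just v)) * G y) targets ∎
        where
          away : ∀ x (x≟v : Dec (x ≡ just v)) →
                 (if does x≟v then 0# else w u x * G (retarget x)) ≈ (if does x≟v then 0# else w u x * G x)
          away x (yes _)   = ≈-refl
          away x (no  x≢v) = *-congˡ (reflexive (cong G (retarget-≢ x x≢v)))
          collect : ∀ y (y≟v : Dec (y ≡ just v)) →
                    (if does y≟v then 0# else w u y * G y) + 𝟙 (y ≟M a) * (w u (just v) * G y)
                      ≈ (if does y≟v then 0# else w u y + 𝟙 (y ≟M a) * w u (just v)) * G y
          collect y (yes y≡v) = ≈-trans (+-identityˡ _)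
            (≈-trans (𝟙* _ (λ y≡a → a≢v (trans (sym y≡a) y≡v))) (≈-sym (zeroˡ _)))
          collect y (no  _)   = ≈-sym (≈-trans (distribʳ _ _ _) (+-congˡ (*-assoc _ _ _)))

  module _ (v : V) (w : Weight) where

    weight-forceParent : ∀ a p → weight (forceParent v a w) p ≈ 𝟙 (p v ≟M a) * weight w p
    weight-forceParent a p = Prod.fold-scale _≟V_ (λ u → forceParent v a w u (p u)) (λ u → w u (p u)) (𝟙 (p v ≟M a))
      vertices-unique (∈-vertices v) (reflexive (forceParent-v v a w (p v)))
      (λ u _ u≢v → reflexive (forceParent-≢ v a w u (p u) u≢v))

    weight-split : ∀ p → weight w p ≈ ∑ (λ a → weight (forceParent v a w) p) targets
    weight-split p = ≈-sym (begin
      ∑ (λ a → weight (forceParent v a w) p) targets ≈⟨ Sum.fold-cong targets (λ a → weight-forceParent a p) ⟩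
      ∑ (λ a → 𝟙 (p v ≟M a) * weight w p) targets    ≈⟨ Sum.fold-cong targets (λ a → *-congʳ (reflexive (𝟙-sym (p v) a))) ⟩
      ∑ (λ a → 𝟙 (a ≟M p v) * weight w p) targets    ≈⟨ ∑-𝟙* (p v) (λ _ → weight w p) ⟩
      weight w p                                      ∎)

    ∑maps-forceParent-loop : ∑maps (λ p → weight (forceParent v (just v) w) p * forest𝟙 p) ≈ 0#
    ∑maps-forceParent-loop = ≈-trans
      (∑maps-cong (λ p → ≈-trans (*-congʳ (weight-forceParent (just v) p)) (vanish p (p v ≟M just v))))
      (Sum.fold-ε (allParentMaps d n))
      where
        vanish : ∀ p → Dec (p v ≡ just v) → (𝟙 (p v ≟M just v) * weight w p) * forest𝟙 p ≈ 0#
        vanish p (yes loop) = ≈-trans (*-congˡ (reflexive (forest𝟙-cyclic (λ acyclic →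
                                selfLoop⇒¬Terminates p v loop (acyclic v))))) (zeroʳ _)
        vanish p (no  pv≢v) = ≈-trans (*-congʳ (𝟙* _ pv≢v)) (zeroˡ _)

    ∑maps-forceParent : ∀ a → a ≢ just v →
      ∑maps (λ p → weight (forceParent v a w) p * forest𝟙 p) ≈ w v a * forestSum (contract v a w)
    ∑maps-forceParent a a≢v = begin
      ∑maps (λ p → weight (forceParent v a w) p * forest𝟙 p)
        ≈⟨ ∑maps-cong (λ p → contractForest p (p v ≟M a)) ⟩
      ∑maps (λ p → weight (forceParent v a w) p * forest𝟙 (λ u → contractMap v a u (p u)))
        ≈⟨ ∑maps-pushforward (contractMap v a) (forceParent v a w) (contractScaled v a w)
             (forceParent-pushforward v a a≢v w) forest𝟙 forest𝟙-resp ⟩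
      ∑maps (λ p → weight (contractScaled v a w) p * forest𝟙 p)
        ≈⟨ ∑maps-cong (λ p → ≈-trans (*-congʳ (weight-contractScaled p)) (*-assoc _ _ _)) ⟩
      ∑maps (λ p → w v a * (weight (contract v a w) p * forest𝟙 p))
        ≈⟨ ≈-sym (∑-distribˡ _ _ (allParentMaps d n)) ⟩
      w v a * forestSum (contract v a w) ∎
      where
        contractForest : ∀ p → Dec (p v ≡ a) →
          weight (forceParent v a w) p * forest𝟙 p ≈ weight (forceParent v a w) p * forest𝟙 (λ u → contractMap v a u (p u))
        contractForest p (yes pv≡a) = *-congˡ (reflexive (forest𝟙-cong
          (contract-acyclic v a a≢v p pv≡a) (contract-acyclic⁻ v a a≢v p pv≡a)))
        contractForest p (no  pv≢a) = ≈-trans (*-congʳ vanish) (≈-trans (zeroˡ _) (≈-sym (≈-trans (*-congʳ vanish) (zeroˡ _))))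
          where
            vanish : weight (forceParent v a w) p ≈ 0#
            vanish = ≈-trans (weight-forceParent a p) (𝟙* _ pv≢a)
        weight-contractScaled : ∀ p → weight (contractScaled v a w) p ≈ w v a * weight (contract v a w) p
        weight-contractScaled p = Prod.fold-scale _≟V_ (λ u → contractScaled v a w u (p u)) (λ u → contract v a w u (p u))
          (w v a) vertices-unique (∈-vertices v) (contractScaled-v v a w (p v))
          (λ u _ u≢v → reflexive (contractScaled-≢ v a w u (p u) u≢v))

    -- Sort the forests by the parent a of v; contracting v → a matches them with the forests of
    -- contract v a w, in which v is an isolated root.
    forestSum-contract : forestSum w ≈ ∑ (Sum.without _≟M_ (just v) (λ a → w v a * forestSum (contract v a w))) targets
    forestSum-contract = begin
      forestSum w                                                     ≈⟨ ∑maps-cong (λ p → *-congʳ (weight-split p)) ⟩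
      ∑maps (λ p → ∑ (λ a → weight (forceParent v a w) p) targets * forest𝟙 p)  ≈⟨ ∑maps-cong (λ p → ∑-distribʳ _ _ targets) ⟩
      ∑maps (λ p → ∑ (λ a → weight (forceParent v a w) p * forest𝟙 p) targets)  ≈⟨ Sum.fold-swap _ (allParentMaps d n) targets ⟩
      ∑ (λ a → ∑maps (λ p → weight (forceParent v a w) p * forest𝟙 p)) targets  ≈⟨ Sum.fold-cong targets (λ a → byParent a (a ≟M just v)) ⟩
      ∑ (Sum.without _≟M_ (just v) (λ a → w v a * forestSum (contract v a w))) targets ∎
      where
        byParent : ∀ a (a≟v : Dec (a ≡ just v)) → ∑maps (λ p → weight (forceParent v a w) p * forest𝟙 p)
                   ≈ (if does a≟v then 0# else w v a * forestSum (contract v a w))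
        byParent a (yes refl) = ∑maps-forceParent-loop
        byParent a (no  a≢v)  = ∑maps-forceParent a a≢v

-- Forest sums in which only the vertices of an active set A may have parents, and only active
-- vertices may be parents: every inactive vertex is a root.
module ActiveForestSums {c ℓ} (R : CommutativeSemiring c ℓ) (d : ℕ) (n : Fin d → ℕ) where
  open CommutativeSemiring R
    renaming (Carrier to C; refl to ≈-refl; sym to ≈-sym; trans to ≈-trans; zero to *-zero)
  open import Relation.Binary.Reasoning.Setoid setoid
  open Contraction R d n public

  activeTarget : (V → Bool) → Maybe V → Bool
  activeTarget A nothing  = true
  activeTarget A (just y) = A y

  onlyRoots : Weight
  onlyRoots u t = 𝟙 (t ≟M nothing)

  restrict : (V → Bool) → Weight → Weight
  restrict A w u t = if A u then (if activeTarget A t then w u t else 0#) else onlyRoots u t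

  forestSumOn : (V → Bool) → Weight → C
  forestSumOn A w = forestSum (restrict A w)

  remove : (V → Bool) → V → V → Bool
  remove A v u = if does (u ≟V v) then false else A u

  redirect : V → Maybe V → Weight → Weight
  redirect v a w u t = w u t + 𝟙 (t ≟M a) * w u (just v)

  rowSum : (V → Bool) → Weight → V → C
  rowSum A w v = ∑ (λ t → if activeTarget A t then w v t else 0#) targets

  remove-self : ∀ A v → remove A v v ≡ false
  remove-self A v with v ≟V v
  ... | yes _   = refl
  ... | no  v≢v = ⊥-elim (v≢v refl)

  remove-other : ∀ A v u → u ≢ v → remove A v u ≡ A u
  remove-other A v u u≢v with u ≟V v
  ... | yes u≡v = ⊥-elim (u≢v u≡v)
  ... | no  _   = refl

  activeTarget-remove : ∀ A v a → a ≢ just v → activeTarget (remove A v) a ≡ activeTarget A a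
  activeTarget-remove A v nothing  _   = refl
  activeTarget-remove A v (just y) y≢v = remove-other A v y (y≢v ∘ cong just)

  𝟙-just≟nothing : ∀ (y : V) → 𝟙 (just y ≟M nothing) ≡ 0#
  𝟙-just≟nothing y = 𝟙-no (just y ≟M nothing) λ ()

  forestSumOn-congʷ : ∀ A {w w′} → (∀ u t → A u ≡ true → activeTarget A t ≡ true → w u t ≈ w′ u t) →
                      forestSumOn A w ≈ forestSumOn A w′
  forestSumOn-congʷ A {w} {w′} w≈w′ = forestSum-cong pointwise
    where
      pointwise : ∀ u t → restrict A w u t ≈ restrict A w′ u t
      pointwise u t with A u in Au | activeTarget A t in At
      ... | true  | true  = w≈w′ u t Au At
      ... | true  | false = ≈-refl
      ... | false | _     = ≈-refl

  forestSumOn-congᴬ : ∀ {A A′} w → (∀ u → A u ≡ A′ u) → forestSumOn A w ≈ forestSumOn A′ w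
  forestSumOn-congᴬ {A} {A′} w A≡A′ = forestSum-cong pointwise
    where
      targets≡ : ∀ t → activeTarget A t ≡ activeTarget A′ t
      targets≡ nothing  = refl
      targets≡ (just y) = A≡A′ y
      pointwise : ∀ u t → restrict A w u t ≈ restrict A′ w u t
      pointwise u t rewrite A≡A′ u | targets≡ t = ≈-refl

  ∑-onlyRoots : ∀ u → ∑ (onlyRoots u) targets ≈ 1#
  ∑-onlyRoots u = ≈-trans (Sum.fold-pick _≟M_ _ targets-unique (∈-targets nothing)
                            (λ t _ t≢∅ → reflexive (𝟙-no (t ≟M nothing) t≢∅)))
                          (reflexive (𝟙-refl nothing))

  -- The only forest of positive onlyRoots-weight is the one without edges.
  forestSum-onlyRoots : forestSum onlyRoots ≈ 1#
  forestSum-onlyRoots = begin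
    forestSum onlyRoots
      ≈⟨ ≈-sym (∑maps-pushforward (λ _ _ → nothing) onlyRoots onlyRoots allRoots forest𝟙 forest𝟙-resp) ⟩
    ∑maps (λ p → weight onlyRoots p * forest𝟙 (λ _ → nothing))
      ≈⟨ ∑maps-cong (λ p → ≈-trans (*-congˡ (reflexive (forest𝟙-acyclic (λ _ → step done)))) (*-identityʳ _)) ⟩
    ∑maps (weight onlyRoots)            ≈⟨ ∑maps-weight onlyRoots ⟩
    ∏ (λ u → ∑ (onlyRoots u) targets) vs ≈⟨ Prod.fold-cong vs ∑-onlyRoots ⟩
    ∏ (λ _ → 1#) vs                      ≈⟨ Prod.fold-ε vs ⟩
    1#                                   ∎
    where
      allRoots : ∀ u (G : Maybe V → C) →
                 ∑ (λ t → onlyRoots u t * G nothing) targets ≈ ∑ (λ t → onlyRoots u t * G t) targets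
      allRoots u G = ≈-trans (∑-𝟙* nothing (λ _ → G nothing)) (≈-sym (∑-𝟙* nothing G))

  forestSumOn-empty : ∀ A w → (∀ y → A y ≡ false) → forestSumOn A w ≈ 1#
  forestSumOn-empty A w allOff = ≈-trans (forestSum-cong (λ u t → reflexive (roots u t))) forestSum-onlyRoots
    where
      roots : ∀ u t → restrict A w u t ≡ onlyRoots u t
      roots u t rewrite allOff u = refl

  module _ (A : V → Bool) (v : V) (w : Weight) (Av : A v ≡ true) where

    contract-restrict : ∀ a → activeTarget A a ≡ true → a ≢ just v →
                        ∀ u t → contract v a (restrict A w) u t ≈ restrict (remove A v) (redirect v a w) u t
    contract-restrict a Aa a≢v u t = byVertex (u ≟V v)
      where
        byVertex : Dec (u ≡ v) → contract v a (restrict A w) u t ≈ restrict (remove A v) (redirect v a w) u t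
        byVertex (yes refl) rewrite remove-self A v = reflexive (contract-v v a (restrict A w) t)
        byVertex (no  u≢v)  = ≈-trans (reflexive (contract-≢ v a (restrict A w) u t u≢v)) (byTarget (t ≟M just v))
          where
            byTarget : (t≟v : Dec (t ≡ just v)) →
                       (if does t≟v then 0# else restrict A w u t + 𝟙 (t ≟M a) * restrict A w u (just v))
                         ≈ restrict (remove A v) (redirect v a w) u t
            byTarget (yes refl) rewrite remove-other A v u u≢v | remove-self A v with A u
            ... | true  = ≈-refl
            ... | false = reflexive (sym (𝟙-just≟nothing v))
            byTarget (no  t≢v) rewrite remove-other A v u u≢v | activeTarget-remove A v t t≢v | Av with A u
            ... | false = ≈-trans (+-congˡ (≈-trans (*-congˡ (reflexive (𝟙-just≟nothing v))) (zeroʳ _))) (+-identityʳ _)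
            ... | true with activeTarget A t in At
            ...   | true  = ≈-refl
            ...   | false = ≈-trans (+-identityˡ _) (𝟙* {m = t} {m′ = a} _ (λ { refl → case-true-false (trans (sym Aa) At) }))
              where
                case-true-false : true ≢ false
                case-true-false ()

    forestSumOn-contract : forestSumOn A w ≈
      ∑ (λ a → if activeTarget (remove A v) a then w v a * forestSumOn (remove A v) (redirect v a w) else 0#) targets
    forestSumOn-contract = ≈-trans (forestSum-contract v (restrict A w)) (Sum.fold-cong targets (λ a → byParent a (a ≟M just v)))
      where
        byParent : ∀ a (a≟v : Dec (a ≡ just v)) →
                   (if does a≟v then 0# else restrict A w v a * forestSum (contract v a (restrict A w)))
                     ≈ (if activeTarget (remove A v) a then w v a * forestSumOn (remove A v) (redirect v a w) else 0#)
        byParent a (yes refl) rewrite remove-self A v = ≈-refl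
        byParent a (no  a≢v) rewrite activeTarget-remove A v a a≢v | Av with activeTarget A a in Aa
        ... | true  = *-congˡ (forestSum-cong (contract-restrict a Aa a≢v))
        ... | false = zeroˡ _

module Merging {c ℓ} (R : CommutativeSemiring c ℓ) (d : ℕ) (n : Fin d → ℕ) where
  open CommutativeSemiring R
    renaming (Carrier to C; refl to ≈-refl; sym to ≈-sym; trans to ≈-trans; zero to *-zero)
  open import Relation.Binary.Reasoning.Setoid setoid
  open import Algebra.Properties.CommutativeSemigroup +-commutativeSemigroup
    using () renaming (xy∙z≈xz∙y to [x+y]+z≈[x+z]+y)
  open import Algebra.Properties.CommutativeSemigroup *-commutativeSemigroup
    using () renaming (x∙yz≈y∙xz to x*[y*z]≈y*[x*z])
  open ActiveForestSums R d n public

  true≢false : true ≢ false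
  true≢false ()

  +𝟙*-≢ : ∀ {m m′} x y → m ≢ m′ → x + 𝟙 (m ≟M m′) * y ≈ x
  +𝟙*-≢ x y m≢m′ = ≈-trans (+-congˡ (𝟙* y m≢m′)) (+-identityʳ x)

  redirect-comm : ∀ {v x a b} (w : Weight) → a ≢ just v → b ≢ just x →
                  ∀ y t → redirect v b (redirect x a w) y t ≈ redirect x a (redirect v b w) y t
  redirect-comm {v} {x} {a} {b} w a≢v b≢x y t = begin
    (w y t + 𝟙 (t ≟M a) * w y (just x)) + 𝟙 (t ≟M b) * (w y (just v) + 𝟙 (just v ≟M a) * w y (just x))
      ≈⟨ +-congˡ (*-congˡ (+𝟙*-≢ _ _ (a≢v ∘ sym))) ⟩
    (w y t + 𝟙 (t ≟M a) * w y (just x)) + 𝟙 (t ≟M b) * w y (just v)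
      ≈⟨ [x+y]+z≈[x+z]+y _ _ _ ⟩
    (w y t + 𝟙 (t ≟M b) * w y (just v)) + 𝟙 (t ≟M a) * w y (just x)
      ≈⟨ +-congˡ (*-congˡ (≈-sym (+𝟙*-≢ _ _ (b≢x ∘ sym)))) ⟩
    (w y t + 𝟙 (t ≟M b) * w y (just v)) + 𝟙 (t ≟M a) * (w y (just x) + 𝟙 (just x ≟M b) * w y (just v)) ∎

  redirect-chain : ∀ {v x b} (w : Weight) → b ≢ just x → ∀ y t → t ≢ just v →
                   redirect v b (redirect x (just v) w) y t ≈ redirect x b (redirect v b w) y t
  redirect-chain {v} {x} {b} w b≢x y t t≢v = begin
    (w y t + 𝟙 (t ≟M just v) * w y (just x)) + 𝟙 (t ≟M b) * (w y (just v) + 𝟙 (just v ≟M just v) * w y (just x))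
      ≈⟨ +-cong (+𝟙*-≢ _ _ t≢v) (*-congˡ (+-congˡ (≈-trans (*-congʳ (reflexive (𝟙-refl (just v)))) (*-identityˡ _)))) ⟩
    w y t + 𝟙 (t ≟M b) * (w y (just v) + w y (just x))
      ≈⟨ +-congˡ (distribˡ _ _ _) ⟩
    w y t + (𝟙 (t ≟M b) * w y (just v) + 𝟙 (t ≟M b) * w y (just x))
      ≈⟨ ≈-sym (+-assoc _ _ _) ⟩
    (w y t + 𝟙 (t ≟M b) * w y (just v)) + 𝟙 (t ≟M b) * w y (just x)
      ≈⟨ +-congˡ (*-congˡ (≈-sym (+𝟙*-≢ _ _ (b≢x ∘ sym)))) ⟩
    (w y t + 𝟙 (t ≟M b) * w y (just v)) + 𝟙 (t ≟M b) * (w y (just x) + 𝟙 (just x ≟M b) * w y (just v)) ∎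

  forestSumOn-single : ∀ A w u → A u ≡ true → (∀ y → A y ≡ true → y ≡ u) → forestSumOn A w ≈ w u nothing
  forestSumOn-single A w u Au only = begin
    forestSumOn A w
      ≈⟨ forestSumOn-contract A u w Au ⟩
    ∑ (λ a → if activeTarget (remove A u) a then w u a * forestSumOn (remove A u) (redirect u a w) else 0#) targets
      ≈⟨ Sum.fold-pick _≟M_ _ targets-unique (∈-targets nothing) inactive ⟩
    w u nothing * forestSumOn (remove A u) (redirect u nothing w)
      ≈⟨ *-congˡ (forestSumOn-empty (remove A u) (redirect u nothing w) none) ⟩
    w u nothing * 1#
      ≈⟨ *-identityʳ _ ⟩
    w u nothing ∎
    where
      none : ∀ y → remove A u y ≡ false
      none y with y ≟V u
      ... | yes _ = refl
      ... | no  y≢u with A y in Ay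
      ...   | false = refl
      ...   | true  = ⊥-elim (y≢u (only y Ay))
      inactive : ∀ a → a ∈ targets → a ≢ nothing →
        (if activeTarget (remove A u) a then w u a * forestSumOn (remove A u) (redirect u a w) else 0#) ≈ 0#
      inactive nothing  _ a≢∅ = ⊥-elim (a≢∅ refl)
      inactive (just y) _ _   rewrite none y = ≈-refl

  rowSum-redirect : ∀ A w x v a → A x ≡ true → activeTarget (remove A x) a ≡ true →
                    rowSum (remove A x) (redirect x a w) v ≈ rowSum A w v
  rowSum-redirect A w x v a Ax Aa = begin
    rowSum (remove A x) (redirect x a w) v
      ≈⟨ Sum.fold-cong targets split ⟩
    ∑ (λ t → row t + 𝟙 (t ≟M a) * w v (just x)) targets
      ≈⟨ Sum.fold-∙ _ _ targets ⟩
    ∑ row targets + ∑ (λ t → 𝟙 (t ≟M a) * w v (just x)) targets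
      ≈⟨ +-congˡ (∑-𝟙* a (λ _ → w v (just x))) ⟩
    ∑ row targets + w v (just x)
      ≈⟨ +-comm _ _ ⟩
    w v (just x) + ∑ row targets
      ≈⟨ +-cong (reflexive (cong (λ b → if b then w v (just x) else 0#) (sym Ax))) (Sum.fold-cong targets kept) ⟩
    (if activeTarget A (just x) then w v (just x) else 0#)
      + ∑ (Sum.without _≟M_ (just x) (λ t → if activeTarget A t then w v t else 0#)) targets
      ≈⟨ ≈-sym (Sum.fold-extract _≟M_ _ targets-unique (∈-targets (just x))) ⟩
    rowSum A w v ∎
    where
      row : Maybe V → C
      row t = if activeTarget (remove A x) t then w v t else 0#
      split : ∀ t → (if activeTarget (remove A x) t then redirect x a w v t else 0#) ≈ row t + 𝟙 (t ≟M a) * w v (just x)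
      split t with activeTarget (remove A x) t in At
      ... | true  = ≈-refl
      ... | false = ≈-sym (≈-trans (+-identityˡ _) (𝟙* {m = t} {m′ = a} _ λ { refl → true≢false (trans (sym Aa) At) }))
      kept : ∀ t → row t ≈ Sum.without _≟M_ (just x) (λ t → if activeTarget A t then w v t else 0#) t
      kept t with t ≟M just x
      ... | yes refl rewrite remove-self A x = ≈-refl
      ... | no  t≢x  rewrite activeTarget-remove A x t t≢x = ≈-refl

  remove-comm : ∀ A x v y → remove (remove A x) v y ≡ remove (remove A v) x y
  remove-comm A x v y with y ≟V v | y ≟V x
  ... | yes _ | yes _ = refl
  ... | yes _ | no  _ = refl
  ... | no  _ | yes _ = refl
  ... | no  _ | no  _ = refl

  -- Contract the extra active vertex x and merge v into u in the contracted sums (the induction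
  -- hypothesis), then swap the two operations back: only the parents a = v and a = u of x interact.
  module MergeStep (A : V → Bool) (w : Weight) (u v x : V) (u≢v : u ≢ v) (Au : A u ≡ true) (Av : A v ≡ true)
                   (x≢u : x ≢ u) (x≢v : x ≢ v) (Ax : A x ≡ true)
                   (IH : ∀ a → activeTarget (remove A x) a ≡ true →
                         forestSumOn (remove A x) (redirect x a w)
                           ≈ rowSum (remove A x) (redirect x a w) v
                             * forestSumOn (remove (remove A x) v) (redirect v (just u) (redirect x a w))) where

    A₋x A₋v A₋xv A₋vx : V → Bool
    A₋x  = remove A x
    A₋v  = remove A v
    A₋xv = remove A₋x v
    A₋vx = remove A₋v x

    contractThenMerge mergeThenContract : Maybe V → C
    contractThenMerge a = if activeTarget A₋x a then w x a * forestSumOn A₋xv (redirect v (just u) (redirect x a w)) else 0#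
    mergeThenContract a = if activeTarget A₋vx a then redirect v (just u) w x a * forestSumOn A₋vx (redirect x a (redirect v (just u) w)) else 0#

    u≢x : just u ≢ just x
    u≢x = x≢u ∘ sym ∘ just-injective

    activeTarget-A₋vx : ∀ a → a ≢ just v → activeTarget A₋vx a ≡ activeTarget A₋x a
    activeTarget-A₋vx nothing  _   = refl
    activeTarget-A₋vx (just y) y≢v with y ≟V x | y ≟V v
    ... | yes _ | _       = refl
    ... | no  _ | yes y≡v = ⊥-elim (y≢v (cong just y≡v))
    ... | no  _ | no  _   = refl

    agree : ∀ a → a ≢ just v → a ≢ just u → contractThenMerge a ≈ mergeThenContract a
    agree a a≢v a≢u rewrite activeTarget-A₋vx a a≢v with activeTarget A₋x a
    ... | false = ≈-refl
    ... | true  = *-cong (≈-sym (+𝟙*-≢ _ _ a≢u))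
                         (≈-trans (forestSumOn-congᴬ (redirect v (just u) (redirect x a w)) (remove-comm A x v))
                                  (forestSumOn-congʷ A₋vx (λ y t _ _ → redirect-comm w a≢v u≢x y t)))

    bothMerged : C
    bothMerged = forestSumOn A₋vx (redirect x (just u) (redirect v (just u) w))

    A₋x-v : A₋x v ≡ true
    A₋x-v = trans (remove-other A x v (x≢v ∘ sym)) Av

    A₋x-u : A₋x u ≡ true
    A₋x-u = trans (remove-other A x u (x≢u ∘ sym)) Au

    A₋vx-v : A₋vx v ≡ false
    A₋vx-v = trans (remove-other A₋v x v (x≢v ∘ sym)) (remove-self A v)

    A₋vx-u : A₋vx u ≡ true
    A₋vx-u = trans (remove-other A₋v x u (x≢u ∘ sym)) (trans (remove-other A v u u≢v) Au)

    contractThenMerge-v : contractThenMerge (just v) ≈ w x (just v) * bothMerged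
    contractThenMerge-v rewrite A₋x-v = *-congˡ (≈-trans
      (forestSumOn-congʷ A₋xv (λ y t _ At → redirect-chain {v = v} {x = x} w u≢x y t
        λ { refl → true≢false (trans (sym At) (remove-self A₋x v)) }))
      (forestSumOn-congᴬ (redirect x (just u) (redirect v (just u) w)) (remove-comm A x v)))

    contractThenMerge-u : contractThenMerge (just u) ≈ w x (just u) * bothMerged
    contractThenMerge-u rewrite A₋x-u = *-congˡ (≈-trans
      (forestSumOn-congʷ A₋xv (λ y t _ _ → redirect-comm w (u≢v ∘ just-injective) u≢x y t))
      (forestSumOn-congᴬ (redirect x (just u) (redirect v (just u) w)) (remove-comm A x v)))

    mergeThenContract-v : mergeThenContract (just v) ≈ 0#
    mergeThenContract-v rewrite A₋vx-v = ≈-refl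

    mergeThenContract-u : mergeThenContract (just u) ≈ (w x (just u) + 𝟙 (just u ≟M just u) * w x (just v)) * bothMerged
    mergeThenContract-u rewrite A₋vx-u = ≈-refl

    agree-v+u : contractThenMerge (just v) + contractThenMerge (just u) ≈ mergeThenContract (just v) + mergeThenContract (just u)
    agree-v+u = begin
      contractThenMerge (just v) + contractThenMerge (just u) ≈⟨ +-cong contractThenMerge-v contractThenMerge-u ⟩
      w x (just v) * bothMerged + w x (just u) * bothMerged   ≈⟨ +-comm _ _ ⟩
      w x (just u) * bothMerged + w x (just v) * bothMerged   ≈⟨ ≈-sym (distribʳ bothMerged _ _) ⟩
      (w x (just u) + w x (just v)) * bothMerged
        ≈⟨ *-congʳ (+-congˡ (≈-sym (≈-trans (*-congʳ (reflexive (𝟙-refl (just u)))) (*-identityˡ _)))) ⟩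
      (w x (just u) + 𝟙 (just u ≟M just u) * w x (just v)) * bothMerged
        ≈⟨ ≈-sym (≈-trans (+-congʳ mergeThenContract-v) (≈-trans (+-identityˡ _) mergeThenContract-u)) ⟩
      mergeThenContract (just v) + mergeThenContract (just u) ∎

    factor : ∀ a → (if activeTarget A₋x a then w x a * forestSumOn A₋x (redirect x a w) else 0#)
                     ≈ rowSum A w v * contractThenMerge a
    factor a with activeTarget A₋x a in Aa
    ... | false = ≈-sym (zeroʳ _)
    ... | true  = begin
      w x a * forestSumOn A₋x (redirect x a w)
        ≈⟨ *-congˡ (IH a Aa) ⟩
      w x a * (rowSum A₋x (redirect x a w) v * forestSumOn A₋xv (redirect v (just u) (redirect x a w)))
        ≈⟨ *-congˡ (*-congʳ (rowSum-redirect A w x v a Ax Aa)) ⟩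
      w x a * (rowSum A w v * forestSumOn A₋xv (redirect v (just u) (redirect x a w)))
        ≈⟨ x*[y*z]≈y*[x*z] _ _ _ ⟩
      rowSum A w v * (w x a * forestSumOn A₋xv (redirect v (just u) (redirect x a w))) ∎

    merged : forestSumOn A w ≈ rowSum A w v * forestSumOn A₋v (redirect v (just u) w)
    merged = begin
      forestSumOn A w
        ≈⟨ forestSumOn-contract A x w Ax ⟩
      ∑ (λ a → if activeTarget A₋x a then w x a * forestSumOn A₋x (redirect x a w) else 0#) targets
        ≈⟨ Sum.fold-cong targets factor ⟩
      ∑ (λ a → rowSum A w v * contractThenMerge a) targets
        ≈⟨ ≈-sym (∑-distribˡ _ contractThenMerge targets) ⟩
      rowSum A w v * ∑ contractThenMerge targets
        ≈⟨ *-congˡ (Sum.fold-cong-except₂ _≟M_ contractThenMerge mergeThenContract targets-unique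
             (∈-targets (just v)) (∈-targets (just u)) (u≢v ∘ sym ∘ just-injective) agree agree-v+u) ⟩
      rowSum A w v * ∑ mergeThenContract targets
        ≈⟨ *-congˡ (≈-sym (forestSumOn-contract A₋v x (redirect v (just u) w) (trans (remove-other A v x x≢v) Ax))) ⟩
      rowSum A w v * forestSumOn A₋v (redirect v (just u) w) ∎

  ActiveWithin : (V → Bool) → V → V → List V → Set
  ActiveWithin A u v ws = ∀ y → A y ≡ true → (y ≡ u ⊎ y ≡ v) ⊎ y ∈ ws

  ActiveWithin-skip : ∀ {A u v x ws} → ActiveWithin A u v (x ∷ ws) → (A x ≡ true → x ≡ u ⊎ x ≡ v) →
                      ActiveWithin A u v ws
  ActiveWithin-skip within x-ok y Ay with within y Ay
  ... | inj₁ y≡u∨v      = inj₁ y≡u∨v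
  ... | inj₂ (here refl) = inj₁ (x-ok Ay)
  ... | inj₂ (there y∈)  = inj₂ y∈

  module MergeBase (A : V → Bool) (w : Weight) (u v : V) (u≢v : u ≢ v) (Au : A u ≡ true) (Av : A v ≡ true)
                   (rows : ∀ t → w u t ≈ w v t) (within : ActiveWithin A u v []) where

    A₋v : V → Bool
    A₋v = remove A v

    N U J : C
    N = w v nothing
    U = w v (just u)
    J = w v (just v)

    inactive : ∀ y → y ≢ u → y ≢ v → A y ≡ false
    inactive y y≢u y≢v with A y in Ay
    ... | false = refl
    ... | true with within y Ay
    ...   | inj₁ (inj₁ y≡u) = ⊥-elim (y≢u y≡u)
    ...   | inj₁ (inj₂ y≡v) = ⊥-elim (y≢v y≡v)

    only-u : ∀ y → A₋v y ≡ true → y ≡ u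
    only-u y A₋vy with y ≟V v
    ... | yes refl = ⊥-elim (true≢false (sym A₋vy))
    ... | no  y≢v with y ≟V u
    ...   | yes y≡u = y≡u
    ...   | no  y≢u = ⊥-elim (true≢false (trans (sym A₋vy) (inactive y y≢u y≢v)))

    A₋v-u : A₋v u ≡ true
    A₋v-u = trans (remove-other A v u u≢v) Au

    byParent : Maybe V → C
    byParent a = if activeTarget A₋v a then w v a * forestSumOn A₋v (redirect v a w) else 0#

    parents : List (Maybe V)
    parents = nothing ∷ just u ∷ []

    rowTargets : List (Maybe V)
    rowTargets = nothing ∷ just u ∷ just v ∷ []

    u≢v′ : just u ≢ just v
    u≢v′ = u≢v ∘ just-injective

    parents-unique : Unique parents
    parents-unique = ((λ ()) ∷ []) ∷ ([] ∷ [])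

    rowTargets-unique : Unique rowTargets
    rowTargets-unique = ((λ ()) ∷ (λ ()) ∷ []) ∷ ((u≢v′ ∷ []) ∷ ([] ∷ []))

    merged-u : forestSumOn A₋v (redirect v (just u) w) ≈ N
    merged-u = ≈-trans (forestSumOn-single A₋v (redirect v (just u) w) u A₋v-u only-u)
                       (≈-trans (+𝟙*-≢ {m = nothing} {m′ = just u} _ _ λ ()) (rows nothing))

    merged-root : forestSumOn A₋v (redirect v nothing w) ≈ N + J
    merged-root = ≈-trans (forestSumOn-single A₋v (redirect v nothing w) u A₋v-u only-u)
      (+-cong (rows nothing) (≈-trans (*-congʳ (reflexive (𝟙-refl nothing))) (≈-trans (*-identityˡ _) (rows (just v)))))

    expand : forestSumOn A w ≈ N * (N + J) + U * N
    expand = begin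
      forestSumOn A w                     ≈⟨ forestSumOn-contract A v w Av ⟩
      ∑ byParent targets                  ≈⟨ Sum.fold-support _≟M_ parents byParent targets-unique parents-unique (λ b _ → ∈-targets b) outside ⟩
      byParent nothing + (byParent (just u) + 0#) ≈⟨ +-cong (*-congˡ merged-root) (≈-trans (+-identityʳ _) parent-u) ⟩
      N * (N + J) + U * N                 ∎
      where
        outside : ∀ a → a ∈ targets → a ∉ parents → byParent a ≈ 0#
        outside nothing  _ a∉ = ⊥-elim (a∉ (here refl))
        outside (just y) _ a∉ with y ≟V v
        ... | yes refl = ≈-refl
        ... | no  y≢v with y ≟V u
        ...   | yes refl = ⊥-elim (a∉ (there (here refl)))
        ...   | no  y≢u rewrite inactive y y≢u y≢v = ≈-refl
        parent-u : byParent (just u) ≈ U * N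
        parent-u rewrite A₋v-u = *-congˡ merged-u

    rowSum-v : rowSum A w v ≈ N + (U + (J + 0#))
    rowSum-v = ≈-trans (Sum.fold-support _≟M_ rowTargets _ targets-unique rowTargets-unique (λ b _ → ∈-targets b) outside) active
      where
        outside : ∀ a → a ∈ targets → a ∉ rowTargets → (if activeTarget A a then w v a else 0#) ≈ 0#
        outside nothing  _ a∉ = ⊥-elim (a∉ (here refl))
        outside (just y) _ a∉ with y ≟V v
        ... | yes refl = ⊥-elim (a∉ (there (there (here refl))))
        ... | no  y≢v with y ≟V u
        ...   | yes refl = ⊥-elim (a∉ (there (here refl)))
        ...   | no  y≢u rewrite inactive y y≢u y≢v = ≈-refl
        active : ∑ (λ a → if activeTarget A a then w v a else 0#) rowTargets ≈ N + (U + (J + 0#))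
        active rewrite Au | Av = ≈-refl

    merged : forestSumOn A w ≈ rowSum A w v * forestSumOn A₋v (redirect v (just u) w)
    merged = begin
      forestSumOn A w                ≈⟨ expand ⟩
      N * (N + J) + U * N            ≈⟨ +-congʳ (distribˡ N N J) ⟩
      (N * N + N * J) + U * N        ≈⟨ [x+y]+z≈[x+z]+y _ _ _ ⟩
      (N * N + U * N) + N * J        ≈⟨ +-cong (+-congʳ (*-comm N N)) (*-comm N J) ⟩
      (N * N + U * N) + J * N        ≈⟨ +-assoc _ _ _ ⟩
      N * N + (U * N + J * N)        ≈⟨ +-congˡ (≈-sym (distribʳ N U J)) ⟩
      N * N + (U + J) * N            ≈⟨ ≈-sym (distribʳ N N (U + J)) ⟩
      (N + (U + J)) * N              ≈⟨ *-cong (≈-sym (≈-trans rowSum-v (+-congˡ (+-congˡ (+-identityʳ J))))) (≈-sym merged-u) ⟩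
      rowSum A w v * forestSumOn A₋v (redirect v (just u) w) ∎

  -- Induction on the other active vertices, each eliminated by contraction (MergeStep); once only
  -- u and v are active both sides are computed explicitly (MergeBase).
  merge : ∀ (ws : List V) A w u v → u ≢ v → A u ≡ true → A v ≡ true → (∀ t → w u t ≈ w v t) →
          ActiveWithin A u v ws → forestSumOn A w ≈ rowSum A w v * forestSumOn (remove A v) (redirect v (just u) w)
  merge [] A w u v u≢v Au Av rows within = MergeBase.merged A w u v u≢v Au Av rows within
  merge (x ∷ ws) A w u v u≢v Au Av rows within with A x in Ax | x ≟V u | x ≟V v
  ... | false | _       | _       = merge ws A w u v u≢v Au Av rows (ActiveWithin-skip within λ Ax′ → ⊥-elim (true≢false (trans (sym Ax′) Ax)))
  ... | true  | yes x≡u | _       = merge ws A w u v u≢v Au Av rows (ActiveWithin-skip within λ _ → inj₁ x≡u)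
  ... | true  | no  _   | yes x≡v = merge ws A w u v u≢v Au Av rows (ActiveWithin-skip within λ _ → inj₂ x≡v)
  ... | true  | no  x≢u | no  x≢v = MergeStep.merged A w u v x u≢v Au Av x≢u x≢v Ax IH
    where
      IH : ∀ a → activeTarget (remove A x) a ≡ true →
           forestSumOn (remove A x) (redirect x a w)
             ≈ rowSum (remove A x) (redirect x a w) v * forestSumOn (remove (remove A x) v) (redirect v (just u) (redirect x a w))
      IH a _ = merge ws (remove A x) (redirect x a w) u v u≢v
        (trans (remove-other A x u (x≢u ∘ sym)) Au) (trans (remove-other A x v (x≢v ∘ sym)) Av)
        (λ t → +-cong (rows t) (*-congˡ (rows (just x)))) within′
        where
          within′ : ActiveWithin (remove A x) u v ws
          within′ y A₋xy with y ≟V x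
          ... | yes refl = ⊥-elim (true≢false (sym A₋xy))
          ... | no  y≢x with within y A₋xy
          ...   | inj₁ y≡u∨v     = inj₁ y≡u∨v
          ...   | inj₂ (here y≡x) = ⊥-elim (y≢x y≡x)
          ...   | inj₂ (there y∈) = inj₂ y∈

module Representatives {c ℓ} (R : CommutativeSemiring c ℓ) (d : ℕ) (n : Fin d → ℕ) (1≤n : ∀ t → 1 ≤ n t)
                       (x : Fin d → (t : Fin d) → Fin (n t) → CommutativeSemiring.Carrier R)
                       (z : Fin d → CommutativeSemiring.Carrier R) where
  open CommutativeSemiring R
    renaming (Carrier to C; refl to ≈-refl; sym to ≈-sym; trans to ≈-trans; zero to *-zero)
  open import Relation.Binary.Reasoning.Setoid setoid
  open Merging R d n public

  type : V → Fin d
  type = proj₁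

  repIndex : (t : Fin d) → Fin (n t)
  repIndex t = fromℕ< (1≤n t)

  rep : Fin d → V
  rep t = t , repIndex t

  isRep : V → Bool
  isRep y = does (y ≟V rep (type y))

  isRep-rep : ∀ s → isRep (rep s) ≡ true
  isRep-rep s with rep s ≟V rep s
  ... | yes _   = refl
  ... | no  s≢s = ⊥-elim (s≢s refl)

  isRep⇒≡rep : ∀ y → isRep y ≡ true → y ≡ rep (type y)
  isRep⇒≡rep y isRep-y with y ≟V rep (type y)
  ... | yes y≡rep = y≡rep

  ¬isRep⇒≢rep : ∀ y → isRep y ≡ false → ∀ s → y ≢ rep s
  ¬isRep⇒≢rep y ¬isRep-y s refl with rep s ≟V rep s
  ... | yes _   = true≢false ¬isRep-y
  ... | no  s≢s = s≢s refl

  xᵛ : Fin d → V → C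
  xᵛ s y = x s (proj₁ y) (proj₂ y)

  fullRow : Fin d → C
  fullRow s = z s + ∑ (xᵛ s) vs

  ofType : Fin d → Fin d → V → C
  ofType s t e = if does (type e ≟F t) then xᵛ s e else 0#

  -- Weight, seen from type s, of the already merged (inactive) vertices of type t.
  mergedWeight : (V → Bool) → Fin d → Fin d → C
  mergedWeight A s t = ∑ (λ e → if A e then 0# else ofType s t e) vs

  -- Vertex weights once the inactive vertices are merged into their representatives: an edge to
  -- a representative also carries the weight of the vertices merged into it.
  mergedW : (V → Bool) → Weight
  mergedW A u nothing  = z (type u)
  mergedW A u (just y) = xᵛ (type u) y + (if isRep y then mergedWeight A (type u) (type y) else 0#)

  mergedWeight-remove : ∀ A e s t → A e ≡ true → mergedWeight (remove A e) s t ≈ mergedWeight A s t + ofType s t e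
  mergedWeight-remove A e s t Ae = begin
    mergedWeight (remove A e) s t
      ≈⟨ Sum.fold-cong vs split ⟩
    ∑ (λ e′ → (if A e′ then 0# else ofType s t e′) + guard+ (e′ ≟V e) (ofType s t e′)) vs
      ≈⟨ Sum.fold-∙ _ _ vs ⟩
    mergedWeight A s t + ∑ (λ e′ → guard+ (e′ ≟V e) (ofType s t e′)) vs
      ≈⟨ +-congˡ (Sum.fold-single _≟V_ (ofType s t) vertices-unique (∈-vertices e)) ⟩
    mergedWeight A s t + ofType s t e ∎
    where
      split : ∀ e′ → (if remove A e e′ then 0# else ofType s t e′)
                     ≈ (if A e′ then 0# else ofType s t e′) + guard+ (e′ ≟V e) (ofType s t e′)
      split e′ with e′ ≟V e
      ... | yes refl rewrite Ae = ≈-sym (+-identityˡ _)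
      ... | no  _    = ≈-sym (+-identityʳ _)

  mergedW-remove : ∀ A e → A e ≡ true → isRep e ≡ false →
                   ∀ u t → mergedW (remove A e) u t ≈ redirect e (just (rep (type e))) (mergedW A) u t
  mergedW-remove A e Ae ¬isRep-e u nothing = ≈-sym (+𝟙*-≢ {m = nothing} {m′ = just (rep (type e))} _ _ λ ())
  mergedW-remove A e Ae ¬isRep-e u (just y) = byTarget (y ≟V rep (type e))
    where
      s = type u
      mergedW-e : mergedW A u (just e) ≈ xᵛ s e
      mergedW-e rewrite ¬isRep-e = +-identityʳ _
      ofType-e : ofType s (type e) e ≈ xᵛ s e
      ofType-e with type e ≟F type e
      ... | yes _   = ≈-refl
      ... | no  t≢t = ⊥-elim (t≢t refl)
      byTarget : Dec (y ≡ rep (type e)) → mergedW (remove A e) u (just y) ≈ redirect e (just (rep (type e))) (mergedW A) u (just y)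
      byTarget (yes refl) = begin
        xᵛ s (rep (type e)) + (if isRep (rep (type e)) then mergedWeight (remove A e) s (type e) else 0#)
          ≈⟨ +-congˡ (reflexive (cong (λ b → if b then mergedWeight (remove A e) s (type e) else 0#) (isRep-rep (type e)))) ⟩
        xᵛ s (rep (type e)) + mergedWeight (remove A e) s (type e)
          ≈⟨ +-congˡ (≈-trans (mergedWeight-remove A e s (type e) Ae) (+-congˡ ofType-e)) ⟩
        xᵛ s (rep (type e)) + (mergedWeight A s (type e) + xᵛ s e)
          ≈⟨ ≈-sym (+-assoc _ _ _) ⟩
        (xᵛ s (rep (type e)) + mergedWeight A s (type e)) + xᵛ s e
          ≈⟨ +-cong (+-congˡ (reflexive (cong (λ b → if b then mergedWeight A s (type e) else 0#) (sym (isRep-rep (type e))))))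
                    (≈-sym (≈-trans (*-congʳ (reflexive (𝟙-refl (just (rep (type e)))))) (≈-trans (*-identityˡ _) mergedW-e))) ⟩
        (xᵛ s (rep (type e)) + (if isRep (rep (type e)) then mergedWeight A s (type e) else 0#))
          + 𝟙 (just (rep (type e)) ≟M just (rep (type e))) * mergedW A u (just e) ∎
      byTarget (no  y≢rep) = ≈-trans (unchanged (isRep y) refl)
                                     (≈-sym (+𝟙*-≢ _ _ (y≢rep ∘ just-injective)))
        where
          unchanged : ∀ b → isRep y ≡ b → mergedW (remove A e) u (just y) ≈ mergedW A u (just y)
          unchanged false isRep-y rewrite isRep-y = ≈-refl
          unchanged true  isRep-y rewrite isRep-y =
            +-congˡ (≈-trans (mergedWeight-remove A e s (type y) Ae) (≈-trans (+-congˡ otherType) (+-identityʳ _)))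
            where
              otherType : ofType s (type y) e ≈ 0#
              otherType with type e ≟F type y
              ... | no  _  = ≈-refl
              ... | yes eq = ⊥-elim (y≢rep (trans (isRep⇒≡rep y isRep-y) (cong rep (sym eq))))

  RowSumsFull : (V → Bool) → Set ℓ
  RowSumsFull A = ∀ v → rowSum A (mergedW A) v ≈ fullRow (type v)

  allActive : V → Bool
  allActive _ = true

  rowSumsFull-allActive : RowSumsFull allActive
  rowSumsFull-allActive v = begin
    rowSum allActive (mergedW allActive) v                   ≈⟨ Sum.fold-cong targets (λ { nothing → ≈-refl ; (just _) → ≈-refl }) ⟩
    z (type v) + ∑ (mergedW allActive v) (map just vs)       ≡⟨ cong (z (type v) +_) (Sum.fold-map (mergedW allActive v) just vs) ⟩
    z (type v) + ∑ (λ y → mergedW allActive v (just y)) vs   ≈⟨ +-congˡ (Sum.fold-cong vs noneMerged) ⟩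
    fullRow (type v)                                         ∎
    where
      noneMerged : ∀ y → mergedW allActive v (just y) ≈ xᵛ (type v) y
      noneMerged y = ≈-trans (+-congˡ empty) (+-identityʳ _)
        where
          empty : (if isRep y then mergedWeight allActive (type v) (type y) else 0#) ≈ 0#
          empty with isRep y
          ... | false = ≈-refl
          ... | true  = Sum.fold-ε vs

  rowSumsFull-remove : ∀ A e → RowSumsFull A → A e ≡ true → isRep e ≡ false → A (rep (type e)) ≡ true →
                       RowSumsFull (remove A e)
  rowSumsFull-remove A e full Ae ¬isRep-e A-rep v = begin
    rowSum (remove A e) (mergedW (remove A e)) v
      ≈⟨ Sum.fold-cong targets (λ t → ifActive t (mergedW-remove A e Ae ¬isRep-e v t)) ⟩
    rowSum (remove A e) (redirect e (just (rep (type e))) (mergedW A)) v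
      ≈⟨ rowSum-redirect A (mergedW A) e v (just (rep (type e))) Ae
           (trans (remove-other A e (rep (type e)) (¬isRep⇒≢rep e ¬isRep-e (type e) ∘ sym)) A-rep) ⟩
    rowSum A (mergedW A) v
      ≈⟨ full v ⟩
    fullRow (type v) ∎
    where
      ifActive : ∀ t {p q} → p ≈ q → (if activeTarget (remove A e) t then p else 0#) ≈ (if activeTarget (remove A e) t then q else 0#)
      ifActive t p≈q with activeTarget (remove A e) t
      ... | true  = p≈q
      ... | false = ≈-refl

  removeAll : (V → Bool) → List V → V → Bool
  removeAll A []       = A
  removeAll A (e ∷ es) = removeAll (remove A e) es

  merge-all : ∀ es A → Unique es → (∀ e → e ∈ es → A e ≡ true × isRep e ≡ false) → (∀ s → A (rep s) ≡ true) →
              RowSumsFull A →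
              forestSumOn A (mergedW A) ≈ ∏ (fullRow ∘ type) es * forestSumOn (removeAll A es) (mergedW (removeAll A es))
  merge-all []       A _          _      _     _    = ≈-sym (*-identityˡ _)
  merge-all (e ∷ es) A (e∉ ∷ ues) active reps full = begin
    forestSumOn A (mergedW A)
      ≈⟨ merge vs A (mergedW A) (rep (type e)) e (¬isRep⇒≢rep e ¬isRep-e (type e) ∘ sym) (reps (type e)) Ae
           (λ { nothing → ≈-refl ; (just _) → ≈-refl }) (λ y _ → inj₂ (∈-vertices y)) ⟩
    rowSum A (mergedW A) e * forestSumOn (remove A e) (redirect e (just (rep (type e))) (mergedW A))
      ≈⟨ *-cong (full e) (forestSumOn-congʷ (remove A e) (λ u t _ _ → ≈-sym (mergedW-remove A e Ae ¬isRep-e u t))) ⟩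
    fullRow (type e) * forestSumOn (remove A e) (mergedW (remove A e))
      ≈⟨ *-congˡ (merge-all es (remove A e) ues active′ reps′
                   (rowSumsFull-remove A e full Ae ¬isRep-e (reps (type e)))) ⟩
    fullRow (type e) * (∏ (fullRow ∘ type) es * forestSumOn (removeAll A (e ∷ es)) (mergedW (removeAll A (e ∷ es))))
      ≈⟨ ≈-sym (*-assoc _ _ _) ⟩
    ∏ (fullRow ∘ type) (e ∷ es) * forestSumOn (removeAll A (e ∷ es)) (mergedW (removeAll A (e ∷ es))) ∎
    where
      Ae : A e ≡ true
      Ae = proj₁ (active e (here refl))
      ¬isRep-e : isRep e ≡ false
      ¬isRep-e = proj₂ (active e (here refl))
      active′ : ∀ e′ → e′ ∈ es → remove A e e′ ≡ true × isRep e′ ≡ false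
      active′ e′ e′∈ with active e′ (there e′∈)
      ... | Ae′ , ¬isRep-e′ = trans (remove-other A e e′ (λ { refl → All.lookup e∉ e′∈ refl })) Ae′ , ¬isRep-e′
      reps′ : ∀ s → remove A e (rep s) ≡ true
      reps′ s = trans (remove-other A e (rep s) (¬isRep⇒≢rep e ¬isRep-e s ∘ sym)) (reps s)

module Quotient {c ℓ} (R : CommutativeSemiring c ℓ) (d : ℕ) (n : Fin d → ℕ) (1≤n : ∀ t → 1 ≤ n t)
                (x : Fin d → (t : Fin d) → Fin (n t) → CommutativeSemiring.Carrier R)
                (z : Fin d → CommutativeSemiring.Carrier R) where
  open CommutativeSemiring R
    renaming (Carrier to C; refl to ≈-refl; sym to ≈-sym; trans to ≈-trans; zero to *-zero)
  open import Relation.Binary.Reasoning.Setoid setoid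
  open Representatives R d n 1≤n x z public
  open Acyclicity

  isRep-index : ∀ t i → isRep (t , i) ≡ does (i ≟F repIndex t)
  isRep-index t i = does-⇔ (mk⇔ (λ { refl → refl }) (λ { refl → refl })) ((t , i) ≟V rep t) (i ≟F repIndex t)

  ∑-reps : (f : V → C) → ∑ (λ y → if isRep y then f y else 0#) vs ≈ ∑ (f ∘ rep) (allFin d)
  ∑-reps f = ≈-trans (∑-vertices _) (Sum.fold-cong (allFin d) λ s →
    ≈-trans (Sum.fold-cong (allFin (n s)) (λ i → reflexive (cong (λ b → if b then f (s , i) else 0#) (isRep-index s i))))
            (Sum.fold-single _≟F_ (λ i → f (s , i)) (Unique.allFin⁺ (n s)) (∈-allFin (repIndex s))))

  typeOf : Maybe V → Maybe (Fin d)
  typeOf nothing  = nothing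
  typeOf (just y) = just (type y)

  liftRep : Maybe (Fin d) → Maybe V
  liftRep nothing  = nothing
  liftRep (just s) = just (rep s)

  keepRep : Maybe V → Maybe V
  keepRep nothing  = nothing
  keepRep (just y) = if isRep y then just y else nothing

  toReps : V → Maybe V → Maybe V
  toReps u m = if isRep u then keepRep m else nothing

  targetsᵈ : List (Maybe (Fin d))
  targetsᵈ = nothing ∷ map just (allFin d)

  forest𝟙ᵈ : ParentMapD d → C
  forest𝟙ᵈ B = 𝟙 (isForest? (allFin d) B)

  forest𝟙ᵈ-resp : ∀ {B B′ : ParentMapD d} → (∀ t → B t ≡ B′ t) → forest𝟙ᵈ B ≈ forest𝟙ᵈ B′
  forest𝟙ᵈ-resp B≗B′ = reflexive (cong (λ b → if b then 1# else 0#)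
    (isForest?-cong (allFin d) ∈-allFin (Acyclic-resp B≗B′) (Acyclic-resp (sym ∘ B≗B′))))

  Γweight : Fin d → Maybe (Fin d) → C
  Γweight s nothing  = z s
  Γweight s (just t) = xsum R d n x z s t

  module _ (q : ParentMap d n) (q-off : ∀ u → isRep u ≡ false → q u ≡ nothing)
           (q-rep : ∀ u y → q u ≡ just y → isRep y ≡ true) where

    quotient : ParentMapD d
    quotient s = typeOf (q (rep s))

    quotient-terminates : ∀ {m} → Terminates q m → (∀ y → m ≡ just y → isRep y ≡ true) → Terminates quotient (typeOf m)
    quotient-terminates done     _     = done
    quotient-terminates {just y} (step t) rep-y = step (subst (λ u → Terminates quotient (typeOf (q u)))
      (isRep⇒≡rep y (rep-y y refl)) (quotient-terminates t (q-rep y)))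

    liftRep-typeOf : ∀ m → (∀ y → m ≡ just y → isRep y ≡ true) → liftRep (typeOf m) ≡ m
    liftRep-typeOf nothing  _     = refl
    liftRep-typeOf (just y) rep-y = cong just (sym (isRep⇒≡rep y (rep-y y refl)))

    lift-terminates : ∀ {m} → Terminates quotient m → Terminates q (liftRep m)
    lift-terminates done = done
    lift-terminates {just s} (step t) = step (subst (Terminates q) (liftRep-typeOf (q (rep s)) (q-rep (rep s))) (lift-terminates t))

    quotient-acyclic : Acyclic q → Acyclic quotient
    quotient-acyclic acyclic s = quotient-terminates (acyclic (rep s)) (λ { y refl → isRep-rep s })

    quotient-acyclic⁻ : Acyclic quotient → Acyclic q
    quotient-acyclic⁻ acyclic u with isRep u in isRep-u
    ... | true  = subst (λ u′ → Terminates q (just u′)) (sym (isRep⇒≡rep u isRep-u)) (lift-terminates (acyclic (type u)))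
    ... | false = step (subst (Terminates q) (sym (q-off u isRep-u)) done)

    forest𝟙-quotient : forest𝟙 q ≡ forest𝟙ᵈ quotient
    forest𝟙-quotient = cong (λ b → if b then 1# else 0#) (does-⇔
      (mk⇔ (λ f → Acyclic⇒IsForest (allFin d) ∈-allFin quotient (quotient-acyclic (IsForest⇒Acyclic vs ∈-vertices q f)))
           (λ f → Acyclic⇒IsForest vs ∈-vertices q (quotient-acyclic⁻ (IsForest⇒Acyclic (allFin d) ∈-allFin quotient f))))
      (isForest? vs q) (isForest? (allFin d) quotient))

  toReps-off : ∀ (p : ParentMap d n) u → isRep u ≡ false → toReps u (p u) ≡ nothing
  toReps-off p u ¬isRep-u rewrite ¬isRep-u = refl

  toReps-rep : ∀ (p : ParentMap d n) u y → toReps u (p u) ≡ just y → isRep y ≡ true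
  toReps-rep p u y eq with isRep u
  toReps-rep p u y () | false
  ... | true with p u
  toReps-rep p u y () | true | nothing
  ... | just y′ with isRep y′ in isRep-y′
  toReps-rep p u y refl | true | just y′ | true = isRep-y′
  toReps-rep p u y ()   | true | just y′ | false

  Γterm : ParentMapD d → C
  Γterm B = prodL R (map z (rootsD B)) * prodL R (map (λ st → xsum R d n x z (proj₁ st) (proj₂ st)) (edges B))

  Γterm-∏ᶠ : ∀ B → Γterm B ≈ ∏ᶠ d (λ s → Γweight s (B s))
  Γterm-∏ᶠ B = begin
    Γterm B
      ≈⟨ *-cong (Prod.fold-filter _ z (allFin d))
                (≈-trans (Prod.fold-filter _ _ pairs) (≈-trans (Prod.fold-concatMap _ _ (allFin d))
                  (Prod.fold-cong (allFin d) (λ s → ≈-trans (reflexive (Prod.fold-map _ (s ,_) (allFin d)))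
                    (Prod.fold-guard-just _≟F_ (xsum R d n x z s) (Unique.allFin⁺ d) ∈-allFin (B s)))))) ⟩
    ∏ (λ s → guard* (T? (is-nothing (B s))) (z s)) (allFin d) * ∏ (λ s → maybe′ (xsum R d n x z s) 1# (B s)) (allFin d)
      ≈⟨ ≈-sym (Prod.fold-∙ _ _ (allFin d)) ⟩
    ∏ (λ s → guard* (T? (is-nothing (B s))) (z s) * maybe′ (xsum R d n x z s) 1# (B s)) (allFin d)
      ≈⟨ Prod.fold-cong (allFin d) (λ s → byParent s (B s)) ⟩
    ∏ (λ s → Γweight s (B s)) (allFin d)
      ≈⟨ ∏-allFin d _ ⟩
    ∏ᶠ d (λ s → Γweight s (B s)) ∎
    where
      pairs = concatMap (λ s → map (s ,_) (allFin d)) (allFin d)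
      byParent : ∀ s (m : Maybe (Fin d)) → guard* (T? (is-nothing m)) (z s) * maybe′ (xsum R d n x z s) 1# m ≈ Γweight s m
      byParent s nothing  = *-identityʳ _
      byParent s (just t) = *-identityˡ _

  Gamma-∑funs : Gamma R d n x z ≈ ∑ (λ B → ∏ᶠ d (λ s → Γweight s (B s)) * forest𝟙ᵈ B) (funs d targetsᵈ)
  Gamma-∑funs = ≈-trans (Sum.fold-filter (isForest? (allFin d)) _ (funs d targetsᵈ))
    (Sum.fold-cong (funs d targetsᵈ) (λ B → ≈-trans (guard+≈𝟙* (isForest? (allFin d) B) _)
                                                 (≈-trans (*-comm _ _) (*-congʳ (Γterm-∏ᶠ B)))))

  module _ (w : Weight) (w-root : ∀ s → w (rep s) nothing ≈ z s)
           (w-edge : ∀ s t → w (rep s) (just (rep t)) ≈ xsum R d n x z s t) where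

    ŵ : Weight
    ŵ = restrict isRep w

    -- Non-representatives are forced roots and edges into them have weight 0.
    toReps-invisible : ∀ u (G : Maybe V → C) → ∑ (λ a → ŵ u a * G (toReps u a)) targets ≈ ∑ (λ a → ŵ u a * G a) targets
    toReps-invisible u G = Sum.fold-cong targets same
      where
        same : ∀ a → ŵ u a * G (toReps u a) ≈ ŵ u a * G a
        same a with isRep u
        same nothing  | false = ≈-refl
        same (just y) | false = ≈-trans (zeroˡ _) (≈-sym (zeroˡ _))
        same nothing  | true  = ≈-refl
        same (just y) | true with isRep y
        ... | true  = ≈-refl
        ... | false = ≈-trans (zeroˡ _) (≈-sym (zeroˡ _))

    Row : Fin d → Set
    Row t = Fin (n t) → Maybe V

    -- Only the row of the representative of type t survives; it is the Γ-weight of t.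
    typeRow-pushforward : ∀ t (G : Maybe (Fin d) → C) → (∀ {a b} → a ≡ b → G a ≈ G b) →
      ∑ (λ g → ∏ᶠ (n t) (λ i → ŵ (t , i) (g i)) * G (typeOf (toReps (rep t) (g (repIndex t))))) (funs (n t) targets)
        ≈ ∑ (λ m → Γweight t m * G m) targetsᵈ
    typeRow-pushforward t G _ = begin
      ∑ (λ g → ∏ᶠ (n t) (λ i → ŵ (t , i) (g i)) * G (typeOf (toReps (rep t) (g (repIndex t))))) (funs (n t) targets)
        ≈⟨ ∑-funs-marginal targets (n t) (repIndex t) (λ i → ŵ (t , i)) (λ a → G (typeOf (toReps (rep t) a))) nonRep-total ⟩
      ŵ (rep t) nothing * G (typeOf (toReps (rep t) nothing)) + ∑ (λ a → ŵ (rep t) a * G (typeOf (toReps (rep t) a))) (map just vs)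
        ≈⟨ +-cong at-root (≈-trans (reflexive (Sum.fold-map _ just vs)) (Sum.fold-cong vs edge)) ⟩
      z t * G nothing + ∑ (λ y → if isRep y then w (rep t) (just y) * G (just (type y)) else 0#) vs
        ≈⟨ +-congˡ (≈-trans (∑-reps (λ y → w (rep t) (just y) * G (just (type y))))
                            (Sum.fold-cong (allFin d) (λ s → *-congʳ (w-edge t s)))) ⟩
      z t * G nothing + ∑ (λ s → xsum R d n x z t s * G (just s)) (allFin d)
        ≡⟨ cong (z t * G nothing +_) (sym (Sum.fold-map (λ m → Γweight t m * G m) just (allFin d))) ⟩
      ∑ (λ m → Γweight t m * G m) targetsᵈ ∎
      where
        nonRep-total : ∀ i → i ≢ repIndex t → ∑ (ŵ (t , i)) targets ≈ 1#
        nonRep-total i i≢r = ≈-trans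
          (Sum.fold-cong targets (λ a → reflexive (cong (λ b → if b then (if activeTarget isRep a then w (t , i) a else 0#)
                                                                   else onlyRoots (t , i) a) ¬isRep)))
          (∑-onlyRoots (t , i))
          where
            ¬isRep : isRep (t , i) ≡ false
            ¬isRep rewrite isRep-index t i with i ≟F repIndex t
            ... | yes i≡r = ⊥-elim (i≢r i≡r)
            ... | no  _   = refl
        at-root : ŵ (rep t) nothing * G (typeOf (toReps (rep t) nothing)) ≈ z t * G nothing
        at-root rewrite isRep-rep t = *-congʳ (w-root t)
        edge : ∀ y → ŵ (rep t) (just y) * G (typeOf (toReps (rep t) (just y)))
                     ≈ (if isRep y then w (rep t) (just y) * G (just (type y)) else 0#)
        edge y rewrite isRep-rep t with isRep y
        ... | true  = ≈-refl
        ... | false = zeroˡ _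

    forestSumOn-reps : forestSumOn isRep w ≈ Gamma R d n x z
    forestSumOn-reps = begin
      forestSum ŵ
        ≈⟨ ≈-sym (∑maps-pushforward toReps ŵ ŵ toReps-invisible forest𝟙 forest𝟙-resp) ⟩
      ∑maps (λ p → weight ŵ p * forest𝟙 (λ u → toReps u (p u)))
        ≈⟨ ∑maps-cong (λ p → *-congˡ (reflexive (forest𝟙-quotient (λ u → toReps u (p u)) (toReps-off p) (toReps-rep p)))) ⟩
      ∑maps (λ p → weight ŵ p * forest𝟙ᵈ (λ s → typeOf (toReps (rep s) (p (rep s)))))
        ≡⟨ ∑maps-curried _ ⟩
      ∑ (λ g → weight ŵ (uncurry g) * forest𝟙ᵈ (typeRow g)) curriedParentMaps
        ≈⟨ Sum.fold-cong curriedParentMaps (λ g → *-congʳ (weight-∏ᶠ ŵ (uncurry g))) ⟩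
      ∑ (λ g → ∏ᶠ d (λ t → ∏ᶠ (n t) (λ i → ŵ (t , i) (g t i))) * forest𝟙ᵈ (typeRow g)) curriedParentMaps
        ≈⟨ ∑-dfuns-pushforward d Row (λ t → funs (n t) targets) (λ _ → Maybe (Fin d)) (λ _ → targetsᵈ) _≡_ (λ _ → refl)
             (λ t g → typeOf (toReps (rep t) (g (repIndex t)))) (λ t g → ∏ᶠ (n t) (λ i → ŵ (t , i) (g i))) Γweight
             typeRow-pushforward forest𝟙ᵈ forest𝟙ᵈ-resp ⟩
      ∑ (λ B → ∏ᶠ d (λ s → Γweight s (B s)) * forest𝟙ᵈ B) (funs d targetsᵈ)
        ≈⟨ ≈-sym Gamma-∑funs ⟩
      Gamma R d n x z ∎
      where
        typeRow : ParentMapᶜ → ParentMapD d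
        typeRow g s = typeOf (toReps (rep s) (g s (repIndex s)))

module TypedForests {c ℓ} (R : CommutativeSemiring c ℓ) (d : ℕ) (n : Fin d → ℕ) (1≤n : ∀ t → 1 ≤ n t)
                    (x : Fin d → (t : Fin d) → Fin (n t) → CommutativeSemiring.Carrier R)
                    (z : Fin d → CommutativeSemiring.Carrier R) where
  open CommutativeSemiring R
    renaming (Carrier to C; refl to ≈-refl; sym to ≈-sym; trans to ≈-trans; zero to *-zero)
  open import Relation.Binary.Reasoning.Setoid setoid
  open Quotient R d n 1≤n x z public

  initialW : Weight
  initialW u nothing  = z (type u)
  initialW u (just y) = xᵛ (type u) y

  forestWeight≈weight : ∀ p → forestWeight R d n x z p ≈ weight initialW p
  forestWeight≈weight p = begin
    ∏ (λ s → pow R (z s) (root p s)) (allFin d) *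
      ∏ (λ s → ∏ (λ t → ∏ (λ i → pow R (x s t i) (ch p s (t , i))) (allFin (n t))) (allFin d)) (allFin d)
      ≈⟨ *-cong (Prod.fold-cong (allFin d) (λ s → pow-length-filter _ (z s) (allFin (n s))))
                (Prod.fold-cong (allFin d) childrenOf) ⟩
    ∏ (λ s → ∏ (λ j → guard* (T? (is-nothing (p (s , j)))) (z s)) (allFin (n s))) (allFin d) *
      ∏ (λ s → ∏ (λ j → maybe′ (xᵛ s) 1# (p (s , j))) (allFin (n s))) (allFin d)
      ≈⟨ ≈-sym (Prod.fold-∙ _ _ (allFin d)) ⟩
    ∏ (λ s → ∏ (λ j → guard* (T? (is-nothing (p (s , j)))) (z s)) (allFin (n s))
           * ∏ (λ j → maybe′ (xᵛ s) 1# (p (s , j))) (allFin (n s))) (allFin d)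
      ≈⟨ Prod.fold-cong (allFin d) (λ s → ≈-trans (≈-sym (Prod.fold-∙ _ _ (allFin (n s))))
                                          (Prod.fold-cong (allFin (n s)) (λ j → byParent s (p (s , j))))) ⟩
    ∏ (λ s → ∏ (λ j → initialW (s , j) (p (s , j))) (allFin (n s))) (allFin d)
      ≈⟨ ≈-sym (∏-vertices _) ⟩
    weight initialW p ∎
    where
      -- Regroup ∏_{t,i} x_{s,t,i}^{ch_s(t,i)} by the children (s , j) of the vertices (t , i).
      childrenOf : ∀ s → ∏ (λ t → ∏ (λ i → pow R (x s t i) (ch p s (t , i))) (allFin (n t))) (allFin d)
                         ≈ ∏ (λ j → maybe′ (xᵛ s) 1# (p (s , j))) (allFin (n s))
      childrenOf s = begin
        ∏ (λ t → ∏ (λ i → pow R (x s t i) (ch p s (t , i))) (allFin (n t))) (allFin d)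
          ≈⟨ Prod.fold-cong (allFin d) (λ t → ≈-trans
               (Prod.fold-cong (allFin (n t)) (λ i → pow-length-filter _ (x s t i) (allFin (n s))))
               (Prod.fold-swap _ (allFin (n t)) (allFin (n s)))) ⟩
        ∏ (λ t → ∏ (λ j → ∏ (λ i → guard* (p (s , j) ≟M just (t , i)) (x s t i)) (allFin (n t))) (allFin (n s))) (allFin d)
          ≈⟨ Prod.fold-swap _ (allFin d) (allFin (n s)) ⟩
        ∏ (λ j → ∏ (λ t → ∏ (λ i → guard* (p (s , j) ≟M just (t , i)) (x s t i)) (allFin (n t))) (allFin d)) (allFin (n s))
          ≈⟨ Prod.fold-cong (allFin (n s)) (λ j → ≈-trans (≈-sym (∏-vertices _))
               (Prod.fold-guard-just _≟V_ (xᵛ s) vertices-unique ∈-vertices (p (s , j)))) ⟩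
        ∏ (λ j → maybe′ (xᵛ s) 1# (p (s , j))) (allFin (n s)) ∎
      byParent : ∀ s {j} (m : Maybe V) → guard* (T? (is-nothing m)) (z s) * maybe′ (xᵛ s) 1# m ≈ initialW (s , j) m
      byParent s nothing  = *-identityʳ _
      byParent s (just y) = *-identityˡ _

  forestGF≈forestSum : forestGF R d n x z ≈ forestSumOn allActive (mergedW allActive)
  forestGF≈forestSum = begin
    forestGF R d n x z
      ≈⟨ Sum.fold-filter (isForest? vs) (forestWeight R d n x z) (allParentMaps d n) ⟩
    ∑maps (λ p → guard+ (isForest? vs p) (forestWeight R d n x z p))
      ≈⟨ ∑maps-cong (λ p → ≈-trans (guard+≈𝟙* (isForest? vs p) _) (≈-trans (*-comm _ _) (*-congʳ (forestWeight≈weight p)))) ⟩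
    forestSum initialW
      ≈⟨ forestSum-cong initial ⟩
    forestSumOn allActive (mergedW allActive) ∎
    where
      initial : ∀ u t → initialW u t ≈ restrict allActive (mergedW allActive) u t
      initial u nothing  = ≈-refl
      initial u (just y) = ≈-sym (≈-trans (+-congˡ noneMerged) (+-identityʳ _))
        where
          noneMerged : (if isRep y then mergedWeight allActive (type u) (type y) else 0#) ≈ 0#
          noneMerged with isRep y
          ... | false = ≈-refl
          ... | true  = Sum.fold-ε vs

  nonReps : List V
  nonReps = filter (λ y → ¬? (y ≟V rep (type y))) vs

  ∈-nonReps : ∀ {y} → y ∈ nonReps → isRep y ≡ false
  ∈-nonReps {y} y∈ with y ≟V rep (type y)
  ... | yes y≡rep = ⊥-elim (proj₂ (∈-filter⁻ (λ y → ¬? (y ≟V rep (type y))) {xs = vs} y∈) y≡rep)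
  ... | no  _     = refl

  ∏-nonReps : ∏ (fullRow ∘ type) nonReps ≈ prodL R (map (λ s → pow R (z s + sumL R (map (xsum R d n x z s) (allFin d))) (n s ∸ 1)) (allFin d))
  ∏-nonReps = begin
    ∏ (fullRow ∘ type) nonReps
      ≈⟨ Prod.fold-filter _ _ vs ⟩
    ∏ (λ y → guard* (¬? (y ≟V rep (type y))) (fullRow (type y))) vs
      ≈⟨ ∏-vertices _ ⟩
    ∏ (λ t → ∏ (λ i → guard* (¬? ((t , i) ≟V rep t)) (fullRow t)) (allFin (n t))) (allFin d)
      ≈⟨ Prod.fold-cong (allFin d) (λ t → ≈-sym (pow-length-filter (λ i → ¬? ((t , i) ≟V rep t)) (fullRow t) (allFin (n t)))) ⟩
    ∏ (λ t → pow R (fullRow t) (length (filter (λ i → ¬? ((t , i) ≟V rep t)) (allFin (n t))))) (allFin d)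
      ≈⟨ Prod.fold-cong (allFin d) (λ t → reflexive (cong (pow R (fullRow t)) (nonRepCount t))) ⟩
    ∏ (λ t → pow R (fullRow t) (n t ∸ 1)) (allFin d)
      ≈⟨ Prod.fold-cong (allFin d) (λ t → pow-cong (n t ∸ 1) (+-congˡ (∑-vertices (xᵛ t)))) ⟩
    prodL R (map (λ s → pow R (z s + sumL R (map (xsum R d n x z s) (allFin d))) (n s ∸ 1)) (allFin d)) ∎
    where
      nonRepCount : ∀ t → length (filter (λ i → ¬? ((t , i) ≟V rep t)) (allFin (n t))) ≡ n t ∸ 1
      nonRepCount t = trans
        (length-filter-except (λ i → ¬? ((t , i) ≟V rep t)) (allFin (n t)) (Unique.allFin⁺ (n t)) (∈-allFin (repIndex t))
          (λ i ≢rep i≡r → ≢rep (cong (t ,_) i≡r)) (λ i i≢r ≡rep → i≢r (index-≡ ≡rep)))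
        (cong (_∸ 1) (length-tabulate {n = n t} id))
        where
          index-≡ : ∀ {i j : Fin (n t)} → _≡_ {A = V} (t , i) (t , j) → i ≡ j
          index-≡ refl = refl

  removeAll-∈ : ∀ es A y → y ∈ es → removeAll A es y ≡ false
  removeAll-∈ (e ∷ es) A y (here refl) = removeAll-∉inactive es (remove A y) y (remove-self A y)
    where
      removeAll-∉inactive : ∀ es A y → A y ≡ false → removeAll A es y ≡ false
      removeAll-∉inactive []       A y Ay = Ay
      removeAll-∉inactive (e ∷ es) A y Ay = removeAll-∉inactive es (remove A e) y (removed e)
        where
          removed : ∀ e → remove A e y ≡ false
          removed e with y ≟V e
          ... | yes _ = refl
          ... | no  _ = Ay
  removeAll-∈ (e ∷ es) A y (there y∈) = removeAll-∈ es (remove A e) y y∈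

  removeAll-∉ : ∀ es A y → y ∉ es → removeAll A es y ≡ A y
  removeAll-∉ []       A y _  = refl
  removeAll-∉ (e ∷ es) A y y∉ = trans (removeAll-∉ es (remove A e) y (y∉ ∘ there)) (remove-other A e y (y∉ ∘ here))

  finalActive : V → Bool
  finalActive = removeAll allActive nonReps

  finalActive≡isRep : ∀ y → finalActive y ≡ isRep y
  finalActive≡isRep y with isRep y in isRep-y
  ... | true  = removeAll-∉ nonReps allActive y (λ y∈ → true≢false (trans (sym isRep-y) (∈-nonReps y∈)))
  ... | false = removeAll-∈ nonReps allActive y
                  (∈-filter⁺ (λ y → ¬? (y ≟V rep (type y))) (∈-vertices y) (¬isRep⇒≢rep y isRep-y (type y)))

  mergedW-rep-edge : ∀ s t → mergedW finalActive (rep s) (just (rep t)) ≈ xsum R d n x z s t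
  mergedW-rep-edge s t = begin
    xᵛ s (rep t) + (if isRep (rep t) then mergedWeight finalActive s t else 0#)
      ≈⟨ +-congˡ (reflexive (cong (λ b → if b then mergedWeight finalActive s t else 0#) (isRep-rep t))) ⟩
    xᵛ s (rep t) + mergedWeight finalActive s t
      ≈⟨ +-congˡ (∑-vertices _) ⟩
    xᵛ s (rep t) + ∑ (λ t′ → ∑ (λ i → merged t′ i) (allFin (n t′))) (allFin d)
      ≈⟨ +-congˡ (Sum.fold-pick _≟F_ _ (Unique.allFin⁺ d) (∈-allFin t)
                   (λ t′ _ t′≢t → Sum.fold-ε-∈ (allFin (n t′)) (λ i _ → otherType t′ i t′≢t))) ⟩
    xᵛ s (rep t) + ∑ (merged t) (allFin (n t))
      ≈⟨ +-congˡ (Sum.fold-cong (allFin (n t)) sameType) ⟩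
    x s t (repIndex t) + ∑ (Sum.without _≟F_ (repIndex t) (x s t)) (allFin (n t))
      ≈⟨ ≈-sym (Sum.fold-extract _≟F_ (x s t) (Unique.allFin⁺ (n t)) (∈-allFin (repIndex t))) ⟩
    xsum R d n x z s t ∎
    where
      merged : (t′ : Fin d) → Fin (n t′) → C
      merged t′ i = if finalActive (t′ , i) then 0# else ofType s t (t′ , i)
      otherType : ∀ t′ i → t′ ≢ t → merged t′ i ≈ 0#
      otherType t′ i t′≢t with finalActive (t′ , i)
      ... | true  = ≈-refl
      ... | false with t′ ≟F t
      ...   | yes t′≡t = ⊥-elim (t′≢t t′≡t)
      ...   | no  _    = ≈-refl
      sameType : ∀ i → merged t i ≈ Sum.without _≟F_ (repIndex t) (x s t) i
      sameType i rewrite finalActive≡isRep (t , i) | isRep-index t i with i ≟F repIndex t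
      ... | yes _ = ≈-refl
      ... | no  _ with t ≟F t
      ...   | yes _   = ≈-refl
      ...   | no  t≢t = ⊥-elim (t≢t refl)

corollary2p2 : ∀ {c ℓ} (R : CommutativeSemiring c ℓ) (d : ℕ) (n : Fin d → ℕ) →
    (∀ t → 1 ≤ n t) →
    (x : Fin d → (t : Fin d) → Fin (n t) → CommutativeSemiring.Carrier R) →
    (z : Fin d → CommutativeSemiring.Carrier R) →
    CommutativeSemiring._≈_ R (forestGF R d n x z) (rhs R d n x z)
corollary2p2 R d n 1≤n x z = begin
  forestGF R d n x z
    ≈⟨ forestGF≈forestSum ⟩
  forestSumOn allActive (mergedW allActive)
    ≈⟨ merge-all nonReps allActive (Unique.filter⁺ _ vertices-unique) (λ e e∈ → refl , ∈-nonReps e∈)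
                 (λ _ → refl) rowSumsFull-allActive ⟩
  ∏ (fullRow ∘ type) nonReps * forestSumOn finalActive (mergedW finalActive)
    ≈⟨ *-cong ∏-nonReps (≈-trans (forestSumOn-congᴬ (mergedW finalActive) finalActive≡isRep)
                                 (forestSumOn-reps (mergedW finalActive) (λ _ → ≈-refl) mergedW-rep-edge)) ⟩
  rhs R d n x z ∎
  where
    open CommutativeSemiring R using (setoid; _*_; *-cong) renaming (refl to ≈-refl; trans to ≈-trans)
    open import Relation.Binary.Reasoning.Setoid setoid
    open TypedForests R d n 1≤n x z
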